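{- For every $n\ge 3$, the following sets of edges $M[X,Y]$ are perfect matchings in $Q_n$ between the vertex sets $X$ and $Y$ (every vertex of $X\cup Y$ is incident to exactly one edge of the set): (i) $M^0[C_{h,i},C_{h,i+1}]$ for every $0\le i<h\le n$; (ii) $M^1[C^-_{1,0},C^-_{1,1}]$, $M^1[C^+_{h,i},C^-_{h+2,i+2}]$, and $M^1[C^+_{h,i},C^-_{h+2,i}]$ for every $0\le i\le h\le n-2$; (iii) $Z^{02}[C^-_{h,i-1},C^-_{h,i}]$ for every $1<i<h\le n$, where $Z^{02}:=\{\{x,z(x)\}\mid x\in C^-_{h,i}\}$.
   Context: $Q_n$: vertices are bitstrings of length $n$, adjacent if they differ in one bit; level $k$ = strings with $k$ ones. $D$ is the set of bitstrings (including the empty string $\varepsilon$) with equally many 0s and 1s such that every prefix has at least as many 0s as 1s. Every vertex $x$ of $Q_n$ can be written uniquely as $x=u_0\,1\,u_1\,1\cdots u_{i-1}\,1\,u_i\,0\,u_{i+1}\,0\cdots 0\,u_h$ with $0\le i\le h$ and $u_0,\ldots,u_h\in D$; $C_{h,i}$ is the set of vertices with these parameters $h,i$, and $C^-_{h,i}$ (resp. $C^+_{h,i}$) is the subset of those with $u_i=\varepsilon$ (resp. $u_i\neq\varepsilon$). For $u\in D$, define $\mathrm{rot}(\varepsilon)=\varepsilon$ and, if $u=0\,v\,1\,w$ with $v,w\in D$, $\mathrm{rot}(u)=v\,0\,w\,1$. For $x\in C^-_{h,i}$ with $1<i<h$, written $x=u_0\,1\cdots u_{i-2}\,1\,u_{i-1}\,1\,0\,u_{i+1}\cdots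 0\,u_h$, define $z(x):=u_0\,1\cdots u_{i-2}\,1\,0\,\mathrm{rot}(u_{i-1})\,0\,u_{i+1}\cdots 0\,u_h$. Lexical matchings: interpret a bitstring as a lattice path from $(0,0)$ where each 1 is a step $(+1,+1)$ and each 0 a step $(+1,-1)$. For $x$ on level $k<n$, let $x'$ be the path obtained by appending $(+1,-1)$-steps to $x$ until it ends at height $-1$ ($x'=x$ if $x$ ends below height $-1$). Scan the down-steps of $x'$ row by row from top to bottom (a step from height $y$ to $y-1$ lies in row $y$), and within each row from right to left; for $p\ge 0$ let $M^{p,\uparrow}(x)$ be the string obtained by flipping the $p$-th down-step encountered (counting from $0$) if this step belongs to $x$, and undefined otherwise. The $p$-lexical matching $M^p$ is the set of all edges $\{x,M^{p,\uparrow}(x)\}$ over all $x$ for which it is defined. For a set $M$ of edges and disjoint vertex sets $X,Y$, $M[X,Y]$ is the set of edges of $M$ with one end in $X$ and the other in $Y$. -}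

module Defs where

open import Data.Bool using (Bool; true; false; not; _∧_; _∨_; T)
open import Data.Nat using (ℕ; zero; suc; _+_; _∸_; _≤_; _<_)
import Data.Nat as ℕ
open import Data.Integer as ℤ using (ℤ; +_; -[1+_])
open import Data.List using (List; []; _∷_; _++_; [_]; length; take; drop; concatMap; replicate)
open import Data.List.Relation.Unary.All using (All)
open import Data.Product using (Σ; _×_; _,_)
open import Data.Sum using (_⊎_)
open import Relation.Binary.PropositionalEquality using (_≡_)
open import Relation.Nullary using (¬_)
open import Relation.Nullary.Decidable using (⌊_⌋)

-- Bitstrings are lists of Bools: false = 0, true = 1.
Bits : Set
Bits = List Bool

ones : Bits → ℕ
ones [] = 0
ones (true ∷ xs) = suc (ones xs)
ones (false ∷ xs) = ones xs

zeros : Bits → ℕ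
zeros [] = 0
zeros (true ∷ xs) = zeros xs
zeros (false ∷ xs) = suc (zeros xs)

-- bit at position j (0-based); positions beyond the end read as 1
-- (only used together with an explicit bound j < length)
bitAt : Bits → ℕ → Bool
bitAt [] _ = true
bitAt (b ∷ bs) zero = b
bitAt (b ∷ bs) (suc j) = bitAt bs j

toggle : Bits → ℕ → Bits
toggle [] _ = []
toggle (b ∷ bs) zero = not b ∷ bs
toggle (b ∷ bs) (suc j) = b ∷ toggle bs j

QEdge : ℕ → Bits → Bits → Set
QEdge n a b = length a ≡ n × Σ ℕ (λ j → j < n × b ≡ toggle a j)

Dyck : Bits → Set
Dyck u = ones u ≡ zeros u × (∀ k → ones (take k u) ≤ zeros (take k u))

glue : ℕ → List Bits → Bits
glue k [] = []
glue zero (v ∷ vs) = false ∷ v ++ glue zero vs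
glue (suc k) (v ∷ vs) = true ∷ v ++ glue k vs

-- assemble i (u_0 ∷ ... ∷ u_h) = u_0 1 u_1 ... 1 u_i 0 u_{i+1} ... 0 u_h
assemble : ℕ → List Bits → Bits
assemble i [] = []
assemble i (u ∷ us) = u ++ glue i us

-- nth element (default ε; only used with in-range indices)
nth : List Bits → ℕ → Bits
nth [] _ = []
nth (u ∷ us) zero = u
nth (u ∷ us) (suc j) = nth us j

Decomp : ℕ → ℕ → List Bits → Bits → Set
Decomp h i us x = i ≤ h × length us ≡ suc h × All Dyck us × x ≡ assemble i us

C : ℕ → ℕ → ℕ → Bits → Set
C n h i x = length x ≡ n × Σ (List Bits) (λ us → Decomp h i us x)

C⁻ : ℕ → ℕ → ℕ → Bits → Set
C⁻ n h i x = length x ≡ n × Σ (List Bits) (λ us → Decomp h i us x × nth us i ≡ [])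

C⁺ : ℕ → ℕ → ℕ → Bits → Set
C⁺ n h i x = length x ≡ n × Σ (List Bits) (λ us → Decomp h i us x × ¬ (nth us i ≡ []))

-- rot on Dyck words (as its graph: Rot u r  means  rot(u) = r)

Rot : Bits → Bits → Set
Rot u r = (u ≡ [] × r ≡ [])
        ⊎ Σ Bits (λ v → Σ Bits (λ w →
            Dyck v × Dyck w × u ≡ false ∷ v ++ true ∷ w × r ≡ v ++ false ∷ w ++ [ true ]))

-- z(x) for x ∈ C^-_{h,i}:  with us = (u_0,...,u_h) and r = rot(u_{i-1}),
--   z(x) = u_0 1 ... u_{i-2} 1  0 r 0  u_{i+1} 0 ... 0 u_h
zForm : ℕ → List Bits → Bits → Bits
zForm i us r =
  concatMap (λ u → u ++ [ true ]) (take (i ∸ 1) us)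
  ++ false ∷ r ++ false ∷ assemble 0 (drop (suc i) us)

ZUp : ℕ → ℕ → ℕ → Bits → Bits → Set
ZUp n h i x y =
  length x ≡ n × Σ (List Bits) (λ us → Decomp h i us x × nth us i ≡ [] ×
     Σ Bits (λ r → Rot (nth us (i ∸ 1)) r × y ≡ zForm i us r))

-- Z^{02} = { {x , z(x)} | x ∈ C^-_{h,i} }, as a symmetric edge relation
Z02 : ℕ → ℕ → ℕ → Bits → Bits → Set
Z02 n h i a b = ZUp n h i a b ⊎ ZUp n h i b a

stepH : Bool → ℤ
stepH true = + 1
stepH false = ℤ.- (+ 1)

height : Bits → ℤ
height [] = + 0
height (b ∷ bs) = stepH b ℤ.+ height bs

-- number of down-steps to append so that the path ends at height -1
extra : ℤ → ℕ
extra (+ k) = suc k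
extra -[1+ k ] = 0

extend : Bits → Bits
extend x = x ++ replicate (extra (height x)) false

row : Bits → ℕ → ℤ
row L s = height (take s L)

-- s is a down-step of L encountered strictly before the down-step at j
-- in the scan (rows top to bottom, each row right to left)
earlier : Bits → ℕ → ℕ → Bool
earlier L j s =
  not (bitAt L s) ∧
  (⌊ row L j ℤ.<? row L s ⌋ ∨ (⌊ row L s ℤ.≟ row L j ⌋ ∧ ⌊ j ℕ.<? s ⌋))

countBelow : (ℕ → Bool) → ℕ → ℕ
countBelow f zero = 0
countBelow f (suc m) = countBelow f m + (if f m then 1 else 0)
  where open import Data.Bool using (if_then_else_)

-- LexUp p x y :  M^{p,↑}(x) is defined and equals y, i.e. the p-th
-- down-step (counting from 0) of x' in the scan order lies in x at
-- position j, and y is x with that bit flipped.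
LexUp : ℕ → Bits → Bits → Set
LexUp p x y = Σ ℕ (λ j →
  j < length x × bitAt x j ≡ false ×
  countBelow (earlier (extend x) j) (length (extend x)) ≡ p ×
  y ≡ toggle x j)

-- M^p as a symmetric edge relation: {x , M^{p,↑}(x)}
Mlex : ℕ → Bits → Bits → Set
Mlex p a b = LexUp p a b ⊎ LexUp p b a

Restrict : (Bits → Bits → Set) → (Bits → Set) → (Bits → Set) → Bits → Bits → Set
Restrict E X Y a b = E a b × ((X a × Y b) ⊎ (Y a × X b))

PerfectMatching : ℕ → (Bits → Bits → Set) → (Bits → Set) → (Bits → Set) → Set
PerfectMatching n E X Y =
  (∀ a b → E a b → QEdge n a b) ×
  (∀ v → X v ⊎ Y v → Σ Bits (λ w → E v w × (∀ w' → E v w' → w' ≡ w)))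

-- Every vertex decomposes uniquely as x = u₀ 1 ⋯ u_{i-1} 1 u_i 0 u_{i+1} ⋯ 0 u_h with Dyck words u_j.
-- As a lattice path, x reaches its maximum at the end of u_i, and no u_j rises above its starting height.
-- Each matching flips one bit in a way that rewrites the decomposition predictably: M⁰ flips the
-- separator after u_i; M¹ flips the separator after u_{i+1}, or the down-step opening the last return
-- of u_i (of u₁ on C⁻_{1,0}); z flips the up-step closing the first return of u_{i-1}.  The heights pin
-- down the scan rank (0 or 1) of the flipped step, so each matching is a one-bit flip that maps one
-- class bijectively onto the other: uniqueness of the decomposition makes it injective, and the level
-- 2i − h, which every flip raises by 2, keeps edges from running backwards.

module Submission where

open import Defs
open import Data.Bool using (true; false; not)
open import Data.Empty using (⊥; ⊥-elim)
open import Data.Integer as ℤ using (ℤ; +_; -[1+_]; +≤+)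
import Data.Integer.Properties as ℤP
open import Data.Integer.Tactic.RingSolver using (solve-∀)
open import Data.List using (List; []; _∷_; _++_; [_]; length; take; drop; replicate; concatMap; initLast; _∷ʳ′_)
open import Data.List.Properties
  using (++-assoc; ++-identityʳ; length-++; length-++-≤ˡ; length-++-≤ʳ; ∷-injective; ∷ʳ-injective; ∷ʳ-injectiveˡ; take-all)
open import Data.List.Relation.Unary.All as All using (All; []; _∷_)
import Data.List.Relation.Unary.All.Properties as AllP
open import Data.Nat as ℕ using (ℕ; zero; suc; _+_; _∸_; _≤_; _<_; z≤n; s≤s)
import Data.Nat.Properties as ℕP
import Data.Nat.Tactic.RingSolver as ℕ-Solver
open import Data.Product using (Σ; _×_; _,_; proj₁; proj₂)
open import Data.Sum using (_⊎_; inj₁; inj₂; swap)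
open import Relation.Binary using (tri<; tri≈; tri>)
open import Relation.Binary.PropositionalEquality hiding ([_])
open import Relation.Nullary using (¬_; yes; no)

height-++ : ∀ (A B : Bits) → height (A ++ B) ≡ height A ℤ.+ height B
height-++ []      B = sym (ℤP.+-identityˡ (height B))
height-++ (b ∷ A) B =
  trans (cong (λ h → stepH b ℤ.+ h) (height-++ A B)) (sym (ℤP.+-assoc (stepH b) (height A) (height B)))

take-++ˡ : ∀ (A B : Bits) {s} → s ≤ length A → take s (A ++ B) ≡ take s A
take-++ˡ A       B {zero}  _         = refl
take-++ˡ (a ∷ A) B {suc s} (s≤s s≤) = cong (a ∷_) (take-++ˡ A B s≤)

take-++ʳ : ∀ (A B : Bits) t → take (length A + t) (A ++ B) ≡ A ++ take t B
take-++ʳ []      B t = refl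
take-++ʳ (a ∷ A) B t = cong (a ∷_) (take-++ʳ A B t)

row-++ˡ : ∀ (A B : Bits) {s} → s ≤ length A → row (A ++ B) s ≡ row A s
row-++ˡ A B s≤ = cong height (take-++ˡ A B s≤)

row-++ʳ : ∀ (A B : Bits) t → row (A ++ B) (length A + t) ≡ height A ℤ.+ row B t
row-++ʳ A B t = trans (cong height (take-++ʳ A B t)) (height-++ A (take t B))

row-length : ∀ (A : Bits) → row A (length A) ≡ height A
row-length A = cong height (take-all (length A) A ℕP.≤-refl)

row-prefix : ∀ (A B : Bits) → row (A ++ B) (length A) ≡ height A
row-prefix A B = trans (row-++ˡ A B ℕP.≤-refl) (row-length A)

data Position (A : Bits) : ℕ → Set where
  inside : ∀ {s} → s < length A → Position A s
  beyond : ∀ t → Position A (length A + t)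

position : ∀ (A : Bits) s → Position A s
position []      s       = beyond s
position (a ∷ A) zero    = inside (s≤s z≤n)
position (a ∷ A) (suc s) with position A s
... | inside s< = inside (s≤s s<)
... | beyond t  = beyond t

bitAt-++ˡ : ∀ (A B : Bits) {s} → s < length A → bitAt (A ++ B) s ≡ bitAt A s
bitAt-++ˡ (a ∷ A) B {zero}  _         = refl
bitAt-++ˡ (a ∷ A) B {suc s} (s≤s s<) = bitAt-++ˡ A B s<

bitAt-++ʳ : ∀ (A B : Bits) t → bitAt (A ++ B) (length A + t) ≡ bitAt B t
bitAt-++ʳ []      B t = refl
bitAt-++ʳ (a ∷ A) B t = bitAt-++ʳ A B t

bitAt-middle : ∀ (A : Bits) b B → bitAt (A ++ b ∷ B) (length A) ≡ b
bitAt-middle []      b B = refl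
bitAt-middle (a ∷ A) b B = bitAt-middle A b B

toggle-++ʳ : ∀ (A B : Bits) t → toggle (A ++ B) (length A + t) ≡ A ++ toggle B t
toggle-++ʳ []      B t = refl
toggle-++ʳ (a ∷ A) B t = cong (a ∷_) (toggle-++ʳ A B t)

toggle-middle : ∀ (A : Bits) b B → toggle (A ++ b ∷ B) (length A) ≡ A ++ not b ∷ B
toggle-middle []      b B = refl
toggle-middle (a ∷ A) b B = cong (a ∷_) (toggle-middle A b B)

toggle-involutive : ∀ (x : Bits) j → toggle (toggle x j) j ≡ x
toggle-involutive []          j       = refl
toggle-involutive (true ∷ x)  zero    = refl
toggle-involutive (false ∷ x) zero    = refl
toggle-involutive (b ∷ x)     (suc j) = cong (b ∷_) (toggle-involutive x j)

length-toggle : ∀ (x : Bits) j → length (toggle x j) ≡ length x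
length-toggle []      j       = refl
length-toggle (b ∷ x) zero    = refl
length-toggle (b ∷ x) (suc j) = cong suc (length-toggle x j)

height-toggle : ∀ (x : Bits) j → bitAt x j ≡ false → height (toggle x j) ≡ height x ℤ.+ + 2
height-toggle (false ∷ x) zero    refl = up-down (height x)
  where
  up-down : ∀ h → + 1 ℤ.+ h ≡ (-[1+ 0 ] ℤ.+ h) ℤ.+ + 2
  up-down = solve-∀
height-toggle (b ∷ x)     (suc j) bit =
  trans (cong (λ h → stepH b ℤ.+ h) (height-toggle x j bit)) (sym (ℤP.+-assoc (stepH b) (height x) (+ 2)))

++-overlap : ∀ (A B A′ B′ : Bits) → A ++ B ≡ A′ ++ B′ →
  (Σ Bits λ m → A′ ≡ A ++ m × B ≡ m ++ B′) ⊎ (Σ Bits λ m → A ≡ A′ ++ m × B′ ≡ m ++ B)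
++-overlap []      B A′       B′ eq = inj₁ (A′ , refl , eq)
++-overlap (a ∷ A) B []       B′ eq = inj₂ (a ∷ A , refl , sym eq)
++-overlap (a ∷ A) B (a′ ∷ A′) B′ eq with ∷-injective eq
... | refl , eq′ with ++-overlap A B A′ B′ eq′
... | inj₁ (m , p , q) = inj₁ (m , cong (a ∷_) p , q)
... | inj₂ (m , p , q) = inj₂ (m , cong (a ∷_) p , q)

++-∷-≢[] : ∀ (a : Bits) {c} R → a ++ c ∷ R ≢ []
++-∷-≢[] []      R ()
++-∷-≢[] (_ ∷ _) R ()

Nonpositive : Bits → Set
Nonpositive B = ∀ t → row B t ℤ.≤ + 0

-- A 1 is an up-step and a 0 a down-step, so Dyck words are the paths back to height 0 that never rise above it.
DyckPath : Bits → Set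
DyckPath u = height u ≡ + 0 × Nonpositive u

+-nonpos-≤ : ∀ a {b} → b ℤ.≤ + 0 → a ℤ.+ b ℤ.≤ a
+-nonpos-≤ a {b} b≤0 = subst (a ℤ.+ b ℤ.≤_) (ℤP.+-identityʳ a) (ℤP.+-monoʳ-≤ a b≤0)

-1+nonpos<0 : ∀ {b} → b ℤ.≤ + 0 → -[1+ 0 ] ℤ.+ b ℤ.< + 0
-1+nonpos<0 {b} b≤0 = ℤP.≤-<-trans (+-nonpos-≤ -[1+ 0 ] b≤0) ℤ.-<+

height≤0 : ∀ {A} → Nonpositive A → height A ℤ.≤ + 0
height≤0 {A} nA = subst (ℤ._≤ + 0) (row-length A) (nA (length A))

Nonpositive-[] : Nonpositive []
Nonpositive-[] zero    = ℤP.≤-refl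
Nonpositive-[] (suc t) = ℤP.≤-refl

Nonpositive-false : ∀ {A} → Nonpositive A → Nonpositive (false ∷ A)
Nonpositive-false nA zero    = ℤP.≤-refl
Nonpositive-false nA (suc t) = ℤP.<⇒≤ (-1+nonpos<0 (nA t))

Nonpositive-++ : ∀ {A B} → Nonpositive A → Nonpositive B → Nonpositive (A ++ B)
Nonpositive-++ {A} {B} nA nB s with position A s
... | inside s< = subst (ℤ._≤ + 0) (sym (row-++ˡ A B (ℕP.<⇒≤ s<))) (nA s)
... | beyond t  = subst (ℤ._≤ + 0) (sym (row-++ʳ A B t)) (ℤP.+-mono-≤ (height≤0 nA) (nB t))

Nonpositive-replicate : ∀ k → Nonpositive (replicate k false)
Nonpositive-replicate zero    = Nonpositive-[]
Nonpositive-replicate (suc k) = Nonpositive-false (Nonpositive-replicate k)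

Nonpositive-head : ∀ {b u} → Nonpositive (b ∷ u) → b ≡ false
Nonpositive-head {true}  nA with nA 1
... | +≤+ ()
Nonpositive-head {false} nA = refl

Nonpositive-suffix : ∀ (A B : Bits) → height A ≡ + 0 → Nonpositive (A ++ B) → Nonpositive B
Nonpositive-suffix A B h≡0 nAB t =
  subst (ℤ._≤ + 0) (trans (row-++ʳ A B t) (trans (cong (ℤ._+ row B t) h≡0) (ℤP.+-identityˡ (row B t))))
    (nAB (length A + t))

height+zeros≡ones : ∀ x → height x ℤ.+ + zeros x ≡ + ones x
height+zeros≡ones []          = refl
height+zeros≡ones (true ∷ x)  = trans (up (height x) (+ zeros x)) (cong (λ k → + 1 ℤ.+ k) (height+zeros≡ones x))
  where
  up : ∀ h z → (+ 1 ℤ.+ h) ℤ.+ z ≡ + 1 ℤ.+ (h ℤ.+ z)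
  up = solve-∀
height+zeros≡ones (false ∷ x) = trans (down (height x) (+ zeros x)) (height+zeros≡ones x)
  where
  down : ∀ h z → (-[1+ 0 ] ℤ.+ h) ℤ.+ (+ 1 ℤ.+ z) ≡ h ℤ.+ z
  down = solve-∀

height≡ones-zeros : ∀ x → height x ≡ + ones x ℤ.- + zeros x
height≡ones-zeros x = trans (cancel (height x) (+ zeros x)) (cong (ℤ._- + zeros x) (height+zeros≡ones x))
  where
  cancel : ∀ h z → h ≡ (h ℤ.+ z) ℤ.- z
  cancel = solve-∀

ones≤zeros⇒height≤0 : ∀ x → ones x ≤ zeros x → height x ℤ.≤ + 0
ones≤zeros⇒height≤0 x o≤z = subst₂ ℤ._≤_ (sym (height≡ones-zeros x)) (ℤP.+-inverseʳ (+ zeros x))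
  (ℤP.+-monoˡ-≤ (ℤ.- + zeros x) (+≤+ o≤z))

height≤0⇒ones≤zeros : ∀ x → height x ℤ.≤ + 0 → ones x ≤ zeros x
height≤0⇒ones≤zeros x h≤0 =
  ℤP.drop‿+≤+ (subst (ℤ._≤ + zeros x) (height+zeros≡ones x) (ℤP.+-monoˡ-≤ (+ zeros x) h≤0))

Dyck⇒DyckPath : ∀ {u} → Dyck u → DyckPath u
Dyck⇒DyckPath {u} (o≡z , prefixes) =
  trans (height≡ones-zeros u) (trans (cong (λ k → + k ℤ.- + zeros u) o≡z) (ℤP.+-inverseʳ (+ zeros u))) ,
  λ t → ones≤zeros⇒height≤0 (take t u) (prefixes t)

DyckPath⇒Dyck : ∀ {u} → DyckPath u → Dyck u
DyckPath⇒Dyck {u} (h≡0 , nU) =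
  ℤP.+-injective (trans (sym (height+zeros≡ones u)) (cong (ℤ._+ + zeros u) h≡0)) ,
  λ t → height≤0⇒ones≤zeros (take t u) (nU t)

DyckPath-[] : DyckPath []
DyckPath-[] = refl , Nonpositive-[]

DyckPath-++ : ∀ {a b} → DyckPath a → DyckPath b → DyckPath (a ++ b)
DyckPath-++ {a} {b} (ha , na) (hb , nb) = trans (height-++ a b) (cong₂ ℤ._+_ ha hb) , Nonpositive-++ na nb

DyckPath-0v1 : ∀ {v} → DyckPath v → DyckPath (false ∷ v ++ [ true ])
DyckPath-0v1 {v} (hv , nv) = cong (λ h → -[1+ 0 ] ℤ.+ h) (trans (height-++ v [ true ]) (cong (ℤ._+ + 1) hv)) , nonpos
  where
  nonpos : Nonpositive (false ∷ v ++ [ true ])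
  nonpos zero    = ℤP.≤-refl
  nonpos (suc s) with position v s
  ... | inside s< = subst (λ r → -[1+ 0 ] ℤ.+ r ℤ.≤ + 0) (sym (row-++ˡ v [ true ] (ℕP.<⇒≤ s<)))
                      (ℤP.<⇒≤ (-1+nonpos<0 (nv s)))
  ... | beyond t  = subst (λ r → -[1+ 0 ] ℤ.+ r ℤ.≤ + 0) (sym (row-++ʳ v [ true ] t)) (last t)
    where
    last : ∀ t → -[1+ 0 ] ℤ.+ (height v ℤ.+ row [ true ] t) ℤ.≤ + 0
    last zero          rewrite hv = ℤP.<⇒≤ ℤ.-<+
    last (suc zero)    rewrite hv = ℤP.≤-refl
    last (suc (suc t)) rewrite hv = ℤP.≤-refl

DyckPath-0v1w : ∀ {v w} → DyckPath v → DyckPath w → DyckPath (false ∷ v ++ true ∷ w)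
DyckPath-0v1w {v} {w} dv dw =
  subst DyckPath (cong (false ∷_) (++-assoc v [ true ] w)) (DyckPath-++ (DyckPath-0v1 dv) dw)

DyckPath-a0b1 : ∀ {a b} → DyckPath a → DyckPath b → DyckPath (a ++ false ∷ b ++ [ true ])
DyckPath-a0b1 da db = DyckPath-++ da (DyckPath-0v1 db)

Bounded : ℤ → Bits → Set
Bounded c v = ∀ s → row v s ℤ.≤ c

firstCrossing : ∀ (w : Bits) c s → row w s ≡ + suc c →
  Σ Bits λ v → Σ Bits λ r → w ≡ v ++ true ∷ r × Bounded (+ c) v × height v ≡ + c
firstCrossing []         c       zero    ()
firstCrossing []         c       (suc s) ()
firstCrossing (true ∷ w) c       zero    ()
firstCrossing (true ∷ w) zero    (suc s) _ = [] , w , refl , (λ { zero → ℤP.≤-refl ; (suc _) → ℤP.≤-refl }) , refl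
firstCrossing (true ∷ w) (suc c) (suc s) reach
  with firstCrossing w c s (trans (after-up (row w s)) (cong (ℤ._+ -[1+ 0 ]) reach))
  where
  after-up : ∀ x → x ≡ (+ 1 ℤ.+ x) ℤ.+ -[1+ 0 ]
  after-up = solve-∀
... | v , r , refl , bounded , hv = true ∷ v , r , refl , bounded′ , cong (λ h → + 1 ℤ.+ h) hv
  where
  bounded′ : Bounded (+ suc c) (true ∷ v)
  bounded′ zero    = +≤+ z≤n
  bounded′ (suc t) = ℤP.+-monoʳ-≤ (+ 1) (bounded t)
firstCrossing (false ∷ w) c zero ()
firstCrossing (false ∷ w) c (suc s) reach
  with firstCrossing w (suc c) s (trans (after-down (row w s)) (trans (cong (ℤ._+ + 1) reach) (cong +_ (ℕP.+-comm (suc c) 1))))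
  where
  after-down : ∀ x → x ≡ (-[1+ 0 ] ℤ.+ x) ℤ.+ + 1
  after-down = solve-∀
... | v , r , refl , bounded , hv = false ∷ v , r , refl , bounded′ , cong (λ h → -[1+ 0 ] ℤ.+ h) hv
  where
  bounded′ : Bounded (+ c) (false ∷ v)
  bounded′ zero    = +≤+ z≤n
  bounded′ (suc t) = ℤP.+-monoʳ-≤ -[1+ 0 ] (bounded t)

-1+h≡0⇒h≡1 : ∀ h → -[1+ 0 ] ℤ.+ h ≡ + 0 → h ≡ + 1
-1+h≡0⇒h≡1 h eq = trans (shift h) (cong (ℤ._+ + 1) eq)
  where
  shift : ∀ h → h ≡ (-[1+ 0 ] ℤ.+ h) ℤ.+ + 1
  shift = solve-∀

h≡0∧h+k≡0⇒k≡0 : ∀ h k → h ≡ + 0 → h ℤ.+ k ≡ + 0 → k ≡ + 0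
h≡0∧h+k≡0⇒k≡0 h k refl eq = trans (sym (ℤP.+-identityˡ k)) eq

split-0v1w : ∀ u → DyckPath u → u ≢ [] →
  Σ Bits λ v → Σ Bits λ w → u ≡ false ∷ v ++ true ∷ w × DyckPath v × DyckPath w
split-0v1w []      _        u≢[] = ⊥-elim (u≢[] refl)
split-0v1w (b ∷ u) (hu , nu) _ with Nonpositive-head nu
... | refl with firstCrossing u 0 (length u) (trans (row-length u) (-1+h≡0⇒h≡1 (height u) hu))
... | v , w , refl , bounded , hv = v , w , refl , dv , (hw , nw)
  where
  dv : DyckPath v
  dv = hv , bounded
  reassoc : false ∷ v ++ true ∷ w ≡ (false ∷ v ++ [ true ]) ++ w
  reassoc = cong (false ∷_) (sym (++-assoc v [ true ] w))
  h0v1 : height (false ∷ v ++ [ true ]) ≡ + 0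
  h0v1 = proj₁ (DyckPath-0v1 dv)
  nw : Nonpositive w
  nw = Nonpositive-suffix (false ∷ v ++ [ true ]) w h0v1 (subst Nonpositive reassoc nu)
  hw : height w ≡ + 0
  hw = h≡0∧h+k≡0⇒k≡0 _ _ h0v1 (trans (sym (height-++ (false ∷ v ++ [ true ]) w)) (trans (cong height (sym reassoc)) hu))

split-a0b1 : ∀ u → DyckPath u → u ≢ [] →
  Σ Bits λ a → Σ Bits λ b → u ≡ a ++ false ∷ b ++ [ true ] × DyckPath a × DyckPath b
split-a0b1 u = go (length u) u ℕP.≤-refl
  where
  go : ∀ fuel u → length u ≤ fuel → DyckPath u → u ≢ [] →
    Σ Bits λ a → Σ Bits λ b → u ≡ a ++ false ∷ b ++ [ true ] × DyckPath a × DyckPath b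
  go fuel u bound du u≢[] with split-0v1w u du u≢[]
  go fuel       u bound        du u≢[] | v , []    , refl , dv , dw = [] , v , refl , DyckPath-[] , dv
  go zero       u ()           du u≢[] | v , c ∷ w , refl , dv , dw
  go (suc fuel) u (s≤s bound)  du u≢[] | v , c ∷ w , refl , dv , dw
    with go fuel (c ∷ w) (ℕP.≤-trans (ℕP.n≤1+n _) (ℕP.≤-trans (length-++-≤ʳ (true ∷ c ∷ w) {v}) bound)) dw (λ ())
  ... | a , b , w≡a0b1 , da , db =
    false ∷ v ++ true ∷ a , b ,
    trans (cong (λ w′ → false ∷ v ++ true ∷ w′) w≡a0b1) (cong (false ∷_) (sym (++-assoc v (true ∷ a) _))) ,
    DyckPath-0v1w dv da , db

no-up-from-0 : ∀ (v m : Bits) → height v ≡ + 0 → ¬ Nonpositive (v ++ true ∷ m)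
no-up-from-0 v m hv nonpos
  with subst (ℤ._≤ + 0) (trans (row-++ʳ v (true ∷ m) 1) (cong (ℤ._+ + 1) hv)) (nonpos (length v + 1))
... | +≤+ ()

0v1w-injective : ∀ {v w v′ w′} → DyckPath v → DyckPath v′ →
  false ∷ v ++ true ∷ w ≡ false ∷ v′ ++ true ∷ w′ → v ≡ v′ × w ≡ w′
0v1w-injective {v} {w} {v′} {w′} (hv , nv) (hv′ , nv′) eq
  with ++-overlap v (true ∷ w) v′ (true ∷ w′) (proj₂ (∷-injective eq))
... | inj₁ ([] , v′≡v , w≡w′) = sym (trans v′≡v (++-identityʳ v)) , proj₂ (∷-injective w≡w′)
... | inj₁ (c ∷ m , v′≡v++m , w≡m) with refl ← proj₁ (∷-injective w≡m) =
  ⊥-elim (no-up-from-0 v m hv (subst Nonpositive v′≡v++m nv′))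
... | inj₂ ([] , v≡v′ , w′≡w) = trans v≡v′ (++-identityʳ v′) , sym (proj₂ (∷-injective w′≡w))
... | inj₂ (c ∷ m , v≡v′++m , w′≡m) with refl ← proj₁ (∷-injective w′≡m) =
  ⊥-elim (no-up-from-0 v′ m hv′ (subst Nonpositive v≡v′++m nv))

a0b1-overlap : ∀ a m b b′ → DyckPath a → DyckPath (a ++ m) → Nonpositive b →
  false ∷ b ++ [ true ] ≡ m ++ false ∷ b′ ++ [ true ] → m ≡ [] × b ≡ b′
a0b1-overlap a []      b b′ da dam nb eq = refl , ∷ʳ-injectiveˡ b b′ (proj₂ (∷-injective eq))
a0b1-overlap a (c ∷ m) b b′ da dam nb eq with ∷-injective eq
... | refl , eq′ = ⊥-elim (impossible (++-overlap b [ true ] m (false ∷ b′ ++ [ true ]) eq′))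
  where
  hm : height m ≡ + 1
  hm = -1+h≡0⇒h≡1 (height m)
         (h≡0∧h+k≡0⇒k≡0 (height a) _ (proj₁ da) (trans (sym (height-++ a (false ∷ m))) (proj₁ dam)))
  impossible : _ → ⊥
  impossible (inj₁ ([]        , _ , ()))
  impossible (inj₁ (_ ∷ []    , _ , ()))
  impossible (inj₁ (_ ∷ _ ∷ _ , _ , ()))
  impossible (inj₂ (k , b≡m++k , _))
    with subst (ℤ._≤ + 0) (trans (row-prefix m k) hm) (subst Nonpositive b≡m++k nb (length m))
  ... | +≤+ ()

a0b1-injective : ∀ {a b a′ b′} → DyckPath a → DyckPath b → DyckPath a′ → DyckPath b′ →
  a ++ false ∷ b ++ [ true ] ≡ a′ ++ false ∷ b′ ++ [ true ] → a ≡ a′ × b ≡ b′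
a0b1-injective {a} {b} {a′} {b′} da db da′ db′ eq with ++-overlap a _ a′ _ eq
... | inj₁ (m , a′≡a++m , rest) with a0b1-overlap a m b b′ da (subst DyckPath a′≡a++m da′) (proj₂ db) rest
...   | refl , b≡b′ = sym (trans a′≡a++m (++-identityʳ a)) , b≡b′
a0b1-injective {a} {b} {a′} {b′} da db da′ db′ eq | inj₂ (m , a≡a′++m , rest)
  with a0b1-overlap a′ m b′ b da′ (subst DyckPath a≡a′++m da) (proj₂ db′) rest
... | refl , b′≡b = trans a≡a′++m (++-identityʳ a′) , sym b′≡b

ups : List Bits → Bits
ups []       = []
ups (u ∷ us) = u ++ true ∷ ups us

downs : List Bits → Bits
downs []       = []
downs (u ∷ us) = false ∷ u ++ downs us

-- compose (u₀ ∷ ⋯ ∷ u_{i-1} ∷ []) u_i (u_{i+1} ∷ ⋯ ∷ u_h ∷ []) = u₀ 1 ⋯ u_{i-1} 1 u_i 0 u_{i+1} ⋯ 0 u_h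
compose : List Bits → Bits → List Bits → Bits
compose []        u post = u ++ downs post
compose (p ∷ pre) u post = p ++ true ∷ compose pre u post

compose-≡ : ∀ pre u post → compose pre u post ≡ ups pre ++ u ++ downs post
compose-≡ []        u post = refl
compose-≡ (p ∷ pre) u post =
  trans (cong (λ q → p ++ true ∷ q) (compose-≡ pre u post)) (sym (++-assoc p (true ∷ ups pre) _))

ups-++ : ∀ (p q : List Bits) → ups (p ++ q) ≡ ups p ++ ups q
ups-++ []      q = refl
ups-++ (u ∷ p) q = trans (cong (λ z → u ++ true ∷ z) (ups-++ p q)) (sym (++-assoc u (true ∷ ups p) (ups q)))

glue-0 : ∀ us → glue 0 us ≡ downs us
glue-0 []       = refl
glue-0 (v ∷ vs) = cong (λ q → false ∷ v ++ q) (glue-0 vs)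

assemble-≡-compose : ∀ pre u post → assemble (length pre) (pre ++ u ∷ post) ≡ compose pre u post
assemble-≡-compose []        u post = cong (u ++_) (glue-0 post)
assemble-≡-compose (p ∷ pre) u post = cong (p ++_) (glue-suc pre)
  where
  glue-suc : ∀ pre → glue (suc (length pre)) (pre ++ u ∷ post) ≡ true ∷ compose pre u post
  glue-suc []        = cong (λ q → true ∷ u ++ q) (glue-0 post)
  glue-suc (v ∷ pre) = cong (λ q → true ∷ v ++ q) (glue-suc pre)

nth-middle : ∀ pre (u : Bits) post → nth (pre ++ u ∷ post) (length pre) ≡ u
nth-middle []        u post = refl
nth-middle (p ∷ pre) u post = nth-middle pre u post

split-at : ∀ i (us : List Bits) → i < length us →
  Σ (List Bits) λ pre → Σ Bits λ u → Σ (List Bits) λ post → us ≡ pre ++ u ∷ post × length pre ≡ i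
split-at zero    (u ∷ us) _        = [] , u , us , refl , refl
split-at (suc i) (v ∷ us) (s≤s i<) with split-at i us i<
... | pre , u , post , refl , refl = v ∷ pre , u , post , refl , refl

record Decomposition (h i : ℕ) (x : Bits) : Set where
  constructor decomposition
  field
    pre         : List Bits
    u           : Bits
    post        : List Bits
    pre-dyck    : All DyckPath pre
    u-dyck      : DyckPath u
    post-dyck   : All DyckPath post
    length-pre  : length pre ≡ i
    length-post : i + length post ≡ h
    x≡compose   : x ≡ compose pre u post

open Decomposition

Decomp⇒Decomposition : ∀ {h i us x} → Decomp h i us x → Σ (Decomposition h i x) λ d → us ≡ pre d ++ u d ∷ post d
Decomp⇒Decomposition {h} {i} {us} (i≤h , length-us , dyck , x≡) with split-at i us (subst (i <_) (sym length-us) (s≤s i≤h))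
... | pre , u , post , refl , refl =
  decomposition pre u post (AllP.++⁻ˡ pre paths) (All.head (AllP.++⁻ʳ pre paths)) (All.tail (AllP.++⁻ʳ pre paths))
    refl lengths (trans x≡ (assemble-≡-compose pre u post)) ,
  refl
  where
  paths : All DyckPath (pre ++ u ∷ post)
  paths = All.map Dyck⇒DyckPath dyck
  lengths : length pre + length post ≡ h
  lengths = ℕP.suc-injective (trans (sym (ℕP.+-suc (length pre) (length post))) (trans (sym (length-++ pre)) length-us))

Decomposition⇒Decomp : ∀ {h i x} (d : Decomposition h i x) → Decomp h i (pre d ++ u d ∷ post d) x
Decomposition⇒Decomp (decomposition pre u post pre-dyck u-dyck post-dyck refl refl x≡) =
  ℕP.m≤m+n (length pre) (length post) ,
  trans (length-++ pre) (ℕP.+-suc (length pre) (length post)) ,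
  AllP.++⁺ (All.map DyckPath⇒Dyck pre-dyck) (DyckPath⇒Dyck u-dyck ∷ All.map DyckPath⇒Dyck post-dyck) ,
  trans x≡ (sym (assemble-≡-compose pre u post))

fromC : ∀ {n h i x} → C n h i x → Decomposition h i x
fromC (_ , _ , dec) = proj₁ (Decomp⇒Decomposition dec)

nth-decomposition : ∀ {h i x} (d : Decomposition h i x) → nth (pre d ++ u d ∷ post d) i ≡ u d
nth-decomposition d = subst (λ k → nth (pre d ++ u d ∷ post d) k ≡ u d) (length-pre d) (nth-middle (pre d) (u d) (post d))

fromC⁻ : ∀ {n h i x} → C⁻ n h i x → Σ (Decomposition h i x) λ d → u d ≡ []
fromC⁻ (_ , _ , dec , empty) with Decomp⇒Decomposition dec
... | d , refl = d , trans (sym (nth-decomposition d)) empty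

fromC⁺ : ∀ {n h i x} → C⁺ n h i x → Σ (Decomposition h i x) λ d → u d ≢ []
fromC⁺ (_ , _ , dec , nonempty) with Decomp⇒Decomposition dec
... | d , refl = d , λ empty → nonempty (trans (nth-decomposition d) empty)

toC : ∀ {n h i x} → length x ≡ n → Decomposition h i x → C n h i x
toC len d = len , _ , Decomposition⇒Decomp d

toC⁻ : ∀ {n h i x} → length x ≡ n → (d : Decomposition h i x) → u d ≡ [] → C⁻ n h i x
toC⁻ len d empty = len , _ , Decomposition⇒Decomp d , trans (nth-decomposition d) empty

toC⁺ : ∀ {n h i x} → length x ≡ n → (d : Decomposition h i x) → u d ≢ [] → C⁺ n h i x
toC⁺ len d nonempty = len , _ , Decomposition⇒Decomp d , λ empty → nonempty (trans (sym (nth-decomposition d)) empty)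

DyckPath-suffix : ∀ {a m} → DyckPath a → DyckPath (a ++ m) → DyckPath m
DyckPath-suffix {a} {m} (ha , _) (ham , nam) =
  h≡0∧h+k≡0⇒k≡0 (height a) (height m) ha (trans (sym (height-++ a m)) ham) , Nonpositive-suffix a m ha nam

NoDyckPrefix : Bits → Set
NoDyckPrefix B = ∀ m r → B ≡ m ++ r → DyckPath m → m ≡ []

dyck-overlap-empty : ∀ {a m B B′} → DyckPath a → DyckPath (a ++ m) → NoDyckPrefix B → B ≡ m ++ B′ → m ≡ []
dyck-overlap-empty {a} {m} {B} {B′} da dam noB B≡m++B′ = noB m B′ B≡m++B′ (DyckPath-suffix da dam)

dyckPrefix-unique : ∀ {a a′ B B′} → DyckPath a → DyckPath a′ → NoDyckPrefix B → NoDyckPrefix B′ →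
  a ++ B ≡ a′ ++ B′ → a ≡ a′ × B ≡ B′
dyckPrefix-unique {a} {a′} {B} {B′} da da′ noB noB′ eq with ++-overlap a B a′ B′ eq
... | inj₁ (m , a′≡a++m , B≡m++B′) with refl ← dyck-overlap-empty da (subst DyckPath a′≡a++m da′) noB B≡m++B′ =
  sym (trans a′≡a++m (++-identityʳ a)) , B≡m++B′
... | inj₂ (m , a≡a′++m , B′≡m++B) with refl ← dyck-overlap-empty da′ (subst DyckPath a≡a′++m da) noB′ B′≡m++B =
  trans a≡a′++m (++-identityʳ a′) , sym B′≡m++B

NoDyckPrefix-[] : NoDyckPrefix []
NoDyckPrefix-[] []      r _  _ = refl
NoDyckPrefix-[] (_ ∷ _) r () _

NoDyckPrefix-true : ∀ R → NoDyckPrefix (true ∷ R)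
NoDyckPrefix-true R []      r _  _          = refl
NoDyckPrefix-true R (c ∷ m) r eq (_ , nonpos) with ∷-injective eq | Nonpositive-head nonpos
... | refl , _ | ()

Nonpositive-downs : ∀ {post} → All DyckPath post → Nonpositive (downs post)
Nonpositive-downs []         = Nonpositive-[]
Nonpositive-downs (dv ∷ dvs) = Nonpositive-false (Nonpositive-++ (proj₂ dv) (Nonpositive-downs dvs))

-- After its first step, 0 v₁ 0 v₂ ⋯ never climbs back to height 0.
NoDyckPrefix-downs : ∀ {post} → All DyckPath post → NoDyckPrefix (downs post)
NoDyckPrefix-downs []                     = NoDyckPrefix-[]
NoDyckPrefix-downs             (dv ∷ dvs) []       r eq dm = refl
NoDyckPrefix-downs {v ∷ post} (dv ∷ dvs) (c ∷ m′) r eq dm with ∷-injective eq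
... | refl , eq′ = ⊥-elim (returns (++-overlap v (downs post) m′ r eq′))
  where
  hm′ : height m′ ≡ + 1
  hm′ = -1+h≡0⇒h≡1 (height m′) (proj₁ dm)
  positive-at : ∀ {A} B → height A ≡ + 1 → ¬ Nonpositive (A ++ B)
  positive-at {A} B hA nonpos with subst (ℤ._≤ + 0) (trans (row-prefix A B) hA) (nonpos (length A))
  ... | +≤+ ()
  returns : _ → ⊥
  returns (inj₁ (k , m′≡v++k , downs≡k++r)) =
    positive-at r hk (subst Nonpositive downs≡k++r (Nonpositive-downs dvs))
    where
    hk : height k ≡ + 1
    hk = trans (sym (ℤP.+-identityˡ (height k)))
           (trans (cong (ℤ._+ height k) (sym (proj₁ dv))) (trans (sym (height-++ v k)) (trans (cong height (sym m′≡v++k)) hm′)))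
  returns (inj₂ (k , v≡m′++k , _)) = positive-at k hm′ (subst Nonpositive v≡m′++k (proj₂ dv))

downs-injective : ∀ {post post′} → All DyckPath post → All DyckPath post′ → downs post ≡ downs post′ → post ≡ post′
downs-injective []         []           _  = refl
downs-injective (dv ∷ dvs) (dv′ ∷ dvs′) eq
  with dyckPrefix-unique dv dv′ (NoDyckPrefix-downs dvs) (NoDyckPrefix-downs dvs′) (proj₂ (∷-injective eq))
... | refl , eq′ = cong (_ ∷_) (downs-injective dvs dvs′ eq′)

compose-injective : ∀ {pre u post pre′ u′ post′} →
  All DyckPath pre → DyckPath u → All DyckPath post →
  All DyckPath pre′ → DyckPath u′ → All DyckPath post′ →
  compose pre u post ≡ compose pre′ u′ post′ → pre ≡ pre′ × u ≡ u′ × post ≡ post′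
compose-injective [] du dpost [] du′ dpost′ eq
  with dyckPrefix-unique du du′ (NoDyckPrefix-downs dpost) (NoDyckPrefix-downs dpost′) eq
... | refl , eq′ = refl , refl , downs-injective dpost dpost′ eq′
compose-injective {post = []} [] du dpost (dp′ ∷ dpre′) du′ dpost′ eq
  with dyckPrefix-unique du dp′ (NoDyckPrefix-downs dpost) (NoDyckPrefix-true _) eq
... | refl , ()
compose-injective {post = _ ∷ _} [] du dpost (dp′ ∷ dpre′) du′ dpost′ eq
  with dyckPrefix-unique du dp′ (NoDyckPrefix-downs dpost) (NoDyckPrefix-true _) eq
... | refl , ()
compose-injective {post′ = []} (dp ∷ dpre) du dpost [] du′ dpost′ eq
  with dyckPrefix-unique dp du′ (NoDyckPrefix-true _) (NoDyckPrefix-downs dpost′) eq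
... | refl , ()
compose-injective {post′ = _ ∷ _} (dp ∷ dpre) du dpost [] du′ dpost′ eq
  with dyckPrefix-unique dp du′ (NoDyckPrefix-true _) (NoDyckPrefix-downs dpost′) eq
... | refl , ()
compose-injective (dp ∷ dpre) du dpost (dp′ ∷ dpre′) du′ dpost′ eq
  with dyckPrefix-unique dp dp′ (NoDyckPrefix-true _) (NoDyckPrefix-true _) eq
... | refl , eq′ with compose-injective dpre du dpost dpre′ du′ dpost′ (proj₂ (∷-injective eq′))
... | refl , refl , refl = refl , refl , refl

decomposition-unique : ∀ {h i h′ i′ x} (d : Decomposition h i x) (d′ : Decomposition h′ i′ x) →
  pre d ≡ pre d′ × u d ≡ u d′ × post d ≡ post d′
decomposition-unique d d′ =
  compose-injective (pre-dyck d) (u-dyck d) (post-dyck d) (pre-dyck d′) (u-dyck d′) (post-dyck d′)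
    (trans (sym (x≡compose d)) (x≡compose d′))

height-ups : ∀ {pre} → All DyckPath pre → height (ups pre) ≡ + length pre
height-ups []                  = refl
height-ups {p ∷ pre} (dp ∷ dps) =
  trans (height-++ p (true ∷ ups pre)) (cong₂ ℤ._+_ (proj₁ dp) (cong (λ h → + 1 ℤ.+ h) (height-ups dps)))

height-downs : ∀ {post} → All DyckPath post → height (downs post) ≡ ℤ.- + length post
height-downs []                  = refl
height-downs {v ∷ post} (dv ∷ dvs) =
  trans (cong (λ h → -[1+ 0 ] ℤ.+ h) (trans (height-++ v (downs post)) (cong₂ ℤ._+_ (proj₁ dv) (height-downs dvs))))
    (down (+ length post))
  where
  down : ∀ k → -[1+ 0 ] ℤ.+ (+ 0 ℤ.+ ℤ.- k) ≡ ℤ.- (+ 1 ℤ.+ k)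
  down = solve-∀

height-compose : ∀ {pre u post} → All DyckPath pre → DyckPath u → All DyckPath post →
  height (compose pre u post) ≡ + length pre ℤ.- + length post
height-compose {pre} {u} {post} dpre (hu , _) dpost = begin
  height (compose pre u post)                             ≡⟨ cong height (compose-≡ pre u post) ⟩
  height (ups pre ++ u ++ downs post)                     ≡⟨ height-++ (ups pre) _ ⟩
  height (ups pre) ℤ.+ height (u ++ downs post)           ≡⟨ cong (λ h → height (ups pre) ℤ.+ h) (height-++ u (downs post)) ⟩
  height (ups pre) ℤ.+ (height u ℤ.+ height (downs post)) ≡⟨ cong₂ (λ a b → a ℤ.+ (height u ℤ.+ b)) (height-ups dpre) (height-downs dpost) ⟩
  + length pre ℤ.+ (height u ℤ.+ ℤ.- + length post)       ≡⟨ cong (λ h → + length pre ℤ.+ (h ℤ.+ ℤ.- + length post)) hu ⟩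
  + length pre ℤ.+ (+ 0 ℤ.+ ℤ.- + length post)           ≡⟨ cong (λ h → + length pre ℤ.+ h) (ℤP.+-identityˡ (ℤ.- + length post)) ⟩
  + length pre ℤ.- + length post                          ∎
  where open ≡-Reasoning

height-decomposition : ∀ {h i x} → Decomposition h i x → height x ℤ.+ + h ≡ + (i + i)
height-decomposition (decomposition pre u post dpre du dpost refl refl refl) = begin
  height (compose pre u post) ℤ.+ + (length pre + length post)
    ≡⟨ cong₂ ℤ._+_ (height-compose dpre du dpost) (ℤP.pos-+ (length pre) (length post)) ⟩
  (+ length pre ℤ.- + length post) ℤ.+ (+ length pre ℤ.+ + length post)
    ≡⟨ cancel (+ length pre) (+ length post) ⟩
  + length pre ℤ.+ + length pre
    ≡⟨ ℤP.pos-+ (length pre) (length pre) ⟨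
  + (length pre + length pre) ∎
  where
  open ≡-Reasoning
  cancel : ∀ a b → (a ℤ.- b) ℤ.+ (a ℤ.+ b) ≡ a ℤ.+ a
  cancel = solve-∀

flip-level : ∀ {h i h′ i′ x y} → Decomposition h i x → Decomposition h′ i′ y →
  height y ≡ height x ℤ.+ + 2 → i′ + i′ + h ≡ i + i + h′ + 2
flip-level {h} {i} {h′} {i′} {x} {y} dx dy hy = ℤP.+-injective (begin
  + (i′ + i′ + h)                          ≡⟨ ℤP.pos-+ (i′ + i′) h ⟩
  + (i′ + i′) ℤ.+ + h                      ≡⟨ cong (ℤ._+ + h) (sym (height-decomposition dy)) ⟩
  (height y ℤ.+ + h′) ℤ.+ + h              ≡⟨ cong (λ k → (k ℤ.+ + h′) ℤ.+ + h) hy ⟩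
  ((height x ℤ.+ + 2) ℤ.+ + h′) ℤ.+ + h    ≡⟨ rearrange (height x) (+ h′) (+ h) ⟩
  ((height x ℤ.+ + h) ℤ.+ + h′) ℤ.+ + 2    ≡⟨ cong (λ k → (k ℤ.+ + h′) ℤ.+ + 2) (height-decomposition dx) ⟩
  (+ (i + i) ℤ.+ + h′) ℤ.+ + 2             ≡⟨ sym (cong (ℤ._+ + 2) (ℤP.pos-+ (i + i) h′)) ⟩
  + (i + i + h′) ℤ.+ + 2                   ≡⟨ sym (ℤP.pos-+ (i + i + h′) 2) ⟩
  + (i + i + h′ + 2)                       ∎)
  where
  open ≡-Reasoning
  rearrange : ∀ a b c → ((a ℤ.+ + 2) ℤ.+ b) ℤ.+ c ≡ ((a ℤ.+ c) ℤ.+ b) ℤ.+ + 2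
  rearrange = solve-∀

Ahead : Bits → ℕ → ℕ → Set
Ahead L j s = row L j ℤ.< row L s ⊎ (row L s ≡ row L j × j < s)

earlier-sound : ∀ L j s → earlier L j s ≡ true → bitAt L s ≡ false × Ahead L j s
earlier-sound L j s eq with bitAt L s | row L j ℤ.<? row L s | row L s ℤ.≟ row L j | j ℕ.<? s
... | false | yes higher | _          | _         = refl , inj₁ higher
... | false | no _       | yes level  | yes right = refl , inj₂ (level , right)
... | false | no _       | yes _      | no _      with () ← eq
... | false | no _       | no _       | _         with () ← eq
... | true  | _          | _          | _         with () ← eq

earlier-complete : ∀ L j s → bitAt L s ≡ false → Ahead L j s → earlier L j s ≡ true
earlier-complete L j s bit ahead
  with bitAt L s | row L j ℤ.<? row L s | row L s ℤ.≟ row L j | j ℕ.<? s | ahead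
... | false | yes _ | _       | _      | _                 = refl
... | false | no ¬h | _       | _      | inj₁ higher       = ⊥-elim (¬h higher)
... | false | no _  | yes _   | yes _  | inj₂ _            = refl
... | false | no _  | yes _   | no ¬r  | inj₂ (_ , right)  = ⊥-elim (¬r right)
... | false | no _  | no ¬l   | _      | inj₂ (level , _)  = ⊥-elim (¬l level)
... | true  | _     | _       | _      | _                 with () ← bit

earlier-false : ∀ L j s → ¬ Ahead L j s → earlier L j s ≡ false
earlier-false L j s ¬ahead with earlier L j s in eq
... | false = refl
... | true  = ⊥-elim (¬ahead (proj₂ (earlier-sound L j s eq)))

¬Ahead-lower : ∀ {L j s} → row L s ℤ.< row L j → ¬ Ahead L j s
¬Ahead-lower lower (inj₁ higher)      = ℤP.<-asym lower higher
¬Ahead-lower lower (inj₂ (level , _)) = ℤP.<-irrefl level lower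

¬Ahead-left : ∀ {L j s} → row L s ℤ.≤ row L j → s ≤ j → ¬ Ahead L j s
¬Ahead-left below s≤j (inj₁ higher)     = ℤP.≤⇒≯ below higher
¬Ahead-left below s≤j (inj₂ (_ , j<s)) = ℕP.≤⇒≯ s≤j j<s

Ahead-trans : ∀ {L j k s} → Ahead L j k → Ahead L k s → Ahead L j s
Ahead-trans (inj₁ p)        (inj₁ q)        = inj₁ (ℤP.<-trans p q)
Ahead-trans {L} {j} (inj₁ p) (inj₂ (q , _)) = inj₁ (subst (row L j ℤ.<_) (sym q) p)
Ahead-trans {L} {s = s} (inj₂ (p , _)) (inj₁ q) = inj₁ (subst (ℤ._< row L s) p q)
Ahead-trans (inj₂ (p , p′)) (inj₂ (q , q′)) = inj₂ (trans q p , ℕP.<-trans p′ q′)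

Ahead-total : ∀ L j k → j ≢ k → Ahead L j k ⊎ Ahead L k j
Ahead-total L j k j≢k with ℤP.<-cmp (row L j) (row L k)
... | tri< p _ _ = inj₁ (inj₁ p)
... | tri> _ _ p = inj₂ (inj₁ p)
... | tri≈ _ e _ with ℕP.<-cmp j k
...   | tri< q _ _ = inj₁ (inj₂ (sym e , q))
...   | tri≈ _ q _ = ⊥-elim (j≢k q)
...   | tri> _ _ q = inj₂ (inj₂ (e , q))

countBelow-none : ∀ f N → (∀ s → s < N → f s ≡ false) → countBelow f N ≡ 0
countBelow-none f zero    _    = refl
countBelow-none f (suc N) none rewrite none N ℕP.≤-refl =
  trans (ℕP.+-identityʳ _) (countBelow-none f N (λ s s< → none s (ℕP.m≤n⇒m≤1+n s<)))

countBelow-single : ∀ f N m → m < N → f m ≡ true → (∀ s → s < N → s ≢ m → f s ≡ false) → countBelow f N ≡ 1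
countBelow-single f (suc N) m (s≤s m≤N) fm others with ℕP.m≤n⇒m<n∨m≡n m≤N
... | inj₂ refl rewrite fm =
  cong (_+ 1) (countBelow-none f N (λ s s< → others s (ℕP.m≤n⇒m≤1+n s<) (λ { refl → ℕP.<-irrefl refl s< })))
... | inj₁ m<N rewrite others N ℕP.≤-refl (λ { refl → ℕP.<-irrefl refl m<N }) =
  trans (ℕP.+-identityʳ _) (countBelow-single f N m m<N fm (λ s s< → others s (ℕP.m≤n⇒m≤1+n s<)))

countBelow-mono : ∀ f g N → (∀ s → s < N → f s ≡ true → g s ≡ true) → countBelow f N ≤ countBelow g N
countBelow-mono f g zero    _ = z≤n
countBelow-mono f g (suc N) f⇒g
  with f N in fN | g N in gN | countBelow-mono f g N (λ s s< → f⇒g s (ℕP.m≤n⇒m≤1+n s<))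
... | false | false | ≤N = ℕP.+-monoˡ-≤ 0 ≤N
... | false | true  | ≤N = ℕP.+-mono-≤ ≤N z≤n
... | true  | true  | ≤N = ℕP.+-monoˡ-≤ 1 ≤N
... | true  | false | _  with () ← trans (sym gN) (f⇒g N ℕP.≤-refl fN)

countBelow-< : ∀ f g N m → (∀ s → s < N → f s ≡ true → g s ≡ true) → m < N → g m ≡ true → f m ≡ false →
  countBelow f N < countBelow g N
countBelow-< f g (suc N) m f⇒g (s≤s m≤N) gm fm with ℕP.m≤n⇒m<n∨m≡n m≤N
... | inj₂ refl rewrite gm | fm =
  ℕP.≤-trans (ℕP.≤-reflexive (cong suc (ℕP.+-identityʳ _)))
    (ℕP.≤-trans (s≤s (countBelow-mono f g m (λ s s< → f⇒g s (ℕP.m≤n⇒m≤1+n s<)))) (ℕP.≤-reflexive (ℕP.+-comm 1 _)))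
... | inj₁ m<N with f N in fN | g N in gN | countBelow-< f g N m (λ s s< → f⇒g s (ℕP.m≤n⇒m≤1+n s<)) m<N gm fm
... | false | false | <N = ℕP.+-mono-<-≤ <N z≤n
... | false | true  | <N = ℕP.+-mono-<-≤ <N z≤n
... | true  | true  | <N = ℕP.+-mono-<-≤ <N ℕP.≤-refl
... | true  | false | _  with () ← trans (sym gN) (f⇒g N ℕP.≤-refl fN)

rank : Bits → ℕ → ℕ
rank L j = countBelow (earlier L j) (length L)

Ahead-irrefl : ∀ L j → ¬ Ahead L j j
Ahead-irrefl L j (inj₁ p)       = ℤP.<-irrefl refl p
Ahead-irrefl L j (inj₂ (_ , p)) = ℕP.<-irrefl refl p

rank-< : ∀ L j k → k < length L → bitAt L k ≡ false → Ahead L j k → rank L k < rank L j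
rank-< L j k k< bit ahead =
  countBelow-< (earlier L k) (earlier L j) (length L) k
    (λ s _ e → earlier-complete L j s (proj₁ (earlier-sound L k s e)) (Ahead-trans ahead (proj₂ (earlier-sound L k s e))))
    k< (earlier-complete L j k bit ahead) (earlier-false L k k (Ahead-irrefl L k))

bitAt-extend : ∀ x {j} → j < length x → bitAt (extend x) j ≡ bitAt x j
bitAt-extend x = bitAt-++ˡ x _

<-length-extend : ∀ x {j} → j < length x → j < length (extend x)
<-length-extend x j< = ℕP.<-≤-trans j< (length-++-≤ˡ x)

LexUp-functional : ∀ {p x y y′} → LexUp p x y → LexUp p x y′ → y ≡ y′
LexUp-functional {x = x} (j , j< , bit , rank≡ , refl) (j′ , j′< , bit′ , rank′≡ , refl) with j ℕ.≟ j′
... | yes refl = refl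
... | no j≢j′ with Ahead-total (extend x) j j′ j≢j′
...   | inj₁ ahead = ⊥-elim (ℕP.<-irrefl (trans rank′≡ (sym rank≡))
          (rank-< (extend x) j j′ (<-length-extend x j′<) (trans (bitAt-extend x j′<) bit′) ahead))
...   | inj₂ ahead = ⊥-elim (ℕP.<-irrefl (trans rank≡ (sym rank′≡))
          (rank-< (extend x) j′ j (<-length-extend x j<) (trans (bitAt-extend x j<) bit) ahead))

EndsAtMax : Bits → Set
EndsAtMax P = ∀ s → row P s ℤ.≤ height P

EndsAboveRest : Bits → Set
EndsAboveRest Q = ∀ s → s < length Q → row Q s ℤ.≤ ℤ.pred (height Q)

dip-≤ : ∀ H {z} → z ℤ.≤ + 0 → H ℤ.+ (-[1+ 0 ] ℤ.+ z) ℤ.≤ ℤ.pred H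
dip-≤ H {z} z≤0 = subst (ℤ._≤ ℤ.pred H) (ℤP.+-assoc H -[1+ 0 ] z)
  (subst (H ℤ.+ -[1+ 0 ] ℤ.+ z ℤ.≤_) (ℤP.+-comm H -[1+ 0 ]) (+-nonpos-≤ (H ℤ.+ -[1+ 0 ]) z≤0))

dip-< : ∀ H {z} → z ℤ.≤ + 0 → H ℤ.+ (-[1+ 0 ] ℤ.+ z) ℤ.< H
dip-< H z≤0 = ℤP.i≤pred[j]⇒i<j (dip-≤ H z≤0)

¬Ahead-summit : ∀ P B → EndsAtMax P → ∀ {s} → s ≤ length P → ¬ Ahead (P ++ B) (length P) s
¬Ahead-summit P B atMax {s} s≤ = ¬Ahead-left (subst₂ ℤ._≤_ (sym (row-++ˡ P B s≤)) (sym (row-prefix P B)) (atMax s)) s≤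

-- The step after P lies in the top row, and every other step of that row lies to its left.
rank-top : ∀ P B → EndsAtMax P → Nonpositive B → rank (P ++ false ∷ B) (length P) ≡ 0
rank-top P B atMax nonpos = countBelow-none (earlier L j) (length L) λ s _ → earlier-false L j s (notAhead s)
  where
  L = P ++ false ∷ B
  j = length P
  row-j : row L j ≡ height P
  row-j = row-prefix P (false ∷ B)
  notAhead : ∀ s → ¬ Ahead L j s
  notAhead s with position P s
  ... | inside s<      = ¬Ahead-summit P _ atMax (ℕP.<⇒≤ s<)
  ... | beyond zero    = ¬Ahead-summit P _ atMax (ℕP.≤-reflexive (ℕP.+-identityʳ j))
  ... | beyond (suc t) = ¬Ahead-lower (subst₂ ℤ._<_ (sym (row-++ʳ P _ (suc t))) (sym row-j) (dip-< (height P) (nonpos t)))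

padding : Bits → Bits
padding x = replicate (extra (height x)) false

Nonpositive-padding : ∀ {R} x → Nonpositive R → Nonpositive (R ++ padding x)
Nonpositive-padding x nR = Nonpositive-++ nR (Nonpositive-replicate (extra (height x)))

padding-nonneg : ∀ x {k} → height x ≡ + k → padding x ≡ false ∷ replicate k false
padding-nonneg x hx = cong (λ h → replicate (extra h) false) hx

length-middle : ∀ (P : Bits) b R → length P < length (P ++ b ∷ R)
length-middle P b R = subst (length P <_) (sym (length-++ P)) (ℕP.m<m+n (length P) (s≤s z≤n))

length-second-middle : ∀ (Q : Bits) b v c R → length Q + suc (length v) < length (Q ++ b ∷ v ++ c ∷ R)
length-second-middle Q b v c R =
  subst (length Q + suc (length v) <_) (sym (trans (length-++ Q) (cong (λ k → length Q + suc k) (length-++ v))))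
    (ℕP.+-monoʳ-< (length Q) (s≤s (ℕP.m<m+n (length v) (s≤s z≤n))))

LexUp-top : ∀ P R → EndsAtMax P → Nonpositive R → LexUp 0 (P ++ false ∷ R) (P ++ true ∷ R)
LexUp-top P R atMax nR =
  length P , length-middle P false R , bitAt-middle P false R ,
  subst (λ L → rank L (length P) ≡ 0) (sym (++-assoc P (false ∷ R) _)) (rank-top P _ atMax (Nonpositive-padding (P ++ false ∷ R) nR)) ,
  sym (toggle-middle P false R)

-- Only the down-step after the closing 1 of b lies in the same row further right.
rank-second : ∀ P b R → EndsAtMax P → DyckPath b → Nonpositive R →
  rank (P ++ false ∷ b ++ true ∷ false ∷ R) (length P) ≡ 1
rank-second P b R atMax (hb , nb) nR =
  countBelow-single (earlier L j) (length L) m m<L (earlier-complete L j m bit-m ahead-m)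
    λ s _ s≢m → earlier-false L j s (notAhead s s≢m)
  where
  T = true ∷ false ∷ R
  L = P ++ false ∷ b ++ T
  j = length P
  m = j + suc (length b + 1)
  H = height P
  row-j : row L j ≡ H
  row-j = row-prefix P _
  row-after-b : ∀ t → row L (j + suc (length b + t)) ≡ H ℤ.+ (-[1+ 0 ] ℤ.+ row T t)
  row-after-b t = trans (row-++ʳ P _ (suc (length b + t)))
    (cong (λ r → H ℤ.+ (-[1+ 0 ] ℤ.+ r)) (trans (row-++ʳ b T t) (trans (cong (ℤ._+ row T t) hb) (ℤP.+-identityˡ (row T t)))))
  m<L : m < length L
  m<L = subst (m <_) (sym (trans (length-++ P) (cong (λ k → j + suc k) (length-++ b))))
    (ℕP.+-monoʳ-< j (s≤s (ℕP.+-monoʳ-< (length b) (s≤s (s≤s z≤n)))))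
  bit-m : bitAt L m ≡ false
  bit-m = trans (bitAt-++ʳ P _ (suc (length b + 1))) (bitAt-++ʳ b T 1)
  ahead-m : Ahead L j m
  ahead-m = inj₂ (trans (row-after-b 1) (trans (ℤP.+-identityʳ H) (sym row-j)) , ℕP.m<m+n j (s≤s z≤n))
  up-down : ∀ r → -[1+ 0 ] ℤ.+ (+ 1 ℤ.+ (-[1+ 0 ] ℤ.+ r)) ≡ -[1+ 0 ] ℤ.+ r
  up-down = solve-∀
  notAhead : ∀ s → s ≢ m → ¬ Ahead L j s
  notAhead s s≢m with position P s
  ... | inside s<   = ¬Ahead-summit P _ atMax (ℕP.<⇒≤ s<)
  ... | beyond zero = ¬Ahead-summit P _ atMax (ℕP.≤-reflexive (ℕP.+-identityʳ j))
  ... | beyond (suc t) with position b t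
  ...   | inside t< = ¬Ahead-lower (subst₂ ℤ._<_
          (sym (trans (row-++ʳ P _ (suc t)) (cong (λ r → H ℤ.+ (-[1+ 0 ] ℤ.+ r)) (row-++ˡ b T (ℕP.<⇒≤ t<)))))
          (sym row-j) (dip-< H (nb t)))
  ...   | beyond zero = ¬Ahead-lower (subst₂ ℤ._<_ (sym (row-after-b 0)) (sym row-j) (dip-< H ℤP.≤-refl))
  ...   | beyond (suc zero) = ⊥-elim (s≢m refl)
  ...   | beyond (suc (suc t′)) = ¬Ahead-lower (subst₂ ℤ._<_
          (sym (trans (row-after-b (suc (suc t′))) (cong (λ r → H ℤ.+ r) (up-down (row R t′))))) (sym row-j) (dip-< H (nR t′)))

NonpositiveSteps : Bits → Set
NonpositiveSteps R = ∀ t → t < length R → row R t ℤ.≤ + 0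

<-length-++⁻ : ∀ (A B : Bits) {t} → length A + t < length (A ++ B) → t < length B
<-length-++⁻ A B {t} t< = ℕP.+-cancelˡ-< (length A) t (length B) (subst (length A + t <_) (length-++ A) t<)

-- Only the down-step right after Q lies in a higher row.
rank-belowPeak : ∀ Q v R → EndsAboveRest Q → DyckPath v → NonpositiveSteps R →
  rank (Q ++ false ∷ v ++ false ∷ R) (length Q + suc (length v)) ≡ 1
rank-belowPeak Q v R aboveRest (hv , nv) nR =
  countBelow-single (earlier L j) (length L) m (length-middle Q false _) (earlier-complete L j m bit-m ahead-m)
    λ s s< s≢m → earlier-false L j s (notAhead s s< s≢m)
  where
  T = false ∷ R
  L = Q ++ false ∷ v ++ T
  m = length Q
  j = m + suc (length v)
  H = height Q
  row-in-v : ∀ t → row L (m + suc t) ≡ H ℤ.+ (-[1+ 0 ] ℤ.+ row (v ++ T) t)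
  row-in-v t = row-++ʳ Q _ (suc t)
  row-after-v : ∀ t → row L (m + suc (length v + t)) ≡ H ℤ.+ (-[1+ 0 ] ℤ.+ row T t)
  row-after-v t = trans (row-in-v (length v + t))
    (cong (λ r → H ℤ.+ (-[1+ 0 ] ℤ.+ r)) (trans (row-++ʳ v T t) (trans (cong (ℤ._+ row T t) hv) (ℤP.+-identityˡ (row T t)))))
  row-j′ : row L j ≡ H ℤ.+ (-[1+ 0 ] ℤ.+ + 0)
  row-j′ = trans (row-in-v (length v)) (cong (λ r → H ℤ.+ (-[1+ 0 ] ℤ.+ r)) (trans (row-prefix v T) hv))
  row-j : row L j ≡ ℤ.pred H
  row-j = trans row-j′ (shift H)
    where
    shift : ∀ H → H ℤ.+ (-[1+ 0 ] ℤ.+ + 0) ≡ -[1+ 0 ] ℤ.+ H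
    shift = solve-∀
  bit-m : bitAt L m ≡ false
  bit-m = bitAt-middle Q false _
  ahead-m : Ahead L j m
  ahead-m = inj₁ (subst₂ ℤ._<_ (sym row-j) (sym (row-prefix Q _)) (ℤP.i≤pred[j]⇒i<j ℤP.≤-refl))
  down-down : ∀ H r → H ℤ.+ (-[1+ 0 ] ℤ.+ (-[1+ 0 ] ℤ.+ r)) ≡ (-[1+ 0 ] ℤ.+ H) ℤ.+ (-[1+ 0 ] ℤ.+ r)
  down-down = solve-∀
  notAhead : ∀ s → s < length L → s ≢ m → ¬ Ahead L j s
  notAhead s s<L s≢m with position Q s
  ... | inside s< = ¬Ahead-left (subst₂ ℤ._≤_ (sym (row-++ˡ Q _ (ℕP.<⇒≤ s<))) (sym row-j) (aboveRest s s<))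
                      (ℕP.≤-trans (ℕP.<⇒≤ s<) (ℕP.m≤m+n m _))
  ... | beyond zero = ⊥-elim (s≢m (ℕP.+-identityʳ m))
  ... | beyond (suc t) with position v t
  ...   | inside t< = ¬Ahead-left
          (subst₂ ℤ._≤_ (sym (trans (row-in-v t) (cong (λ r → H ℤ.+ (-[1+ 0 ] ℤ.+ r)) (row-++ˡ v T (ℕP.<⇒≤ t<)))))
            (sym row-j) (dip-≤ H (nv t)))
          (ℕP.+-monoʳ-≤ m (s≤s (ℕP.<⇒≤ t<)))
  ...   | beyond zero = ¬Ahead-left
          (ℤP.≤-reflexive (trans (row-after-v 0) (sym row-j′)))
          (ℕP.≤-reflexive (cong (λ k → m + suc k) (ℕP.+-identityʳ (length v))))
  ...   | beyond (suc t′) = ¬Ahead-lower (subst₂ ℤ._<_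
          (sym (trans (row-after-v (suc t′)) (down-down H (row R t′)))) (sym row-j) (dip-< (ℤ.pred H) (nR t′ t′<R)))
    where
    t′<R : t′ < length R
    t′<R = ℕP.≤-pred (<-length-++⁻ v T (ℕP.≤-pred (<-length-++⁻ Q (false ∷ v ++ T) s<L)))

LexUp-second : ∀ P b T R → EndsAtMax P → DyckPath b → Nonpositive R →
  T ++ padding (P ++ false ∷ b ++ true ∷ T) ≡ false ∷ R →
  LexUp 1 (P ++ false ∷ b ++ true ∷ T) (P ++ true ∷ b ++ true ∷ T)
LexUp-second P b T R atMax db nR padded =
  length P , length-middle P false _ , bitAt-middle P false _ ,
  subst (λ L → rank L (length P) ≡ 1) (sym extended) (rank-second P b R atMax db nR) ,
  sym (toggle-middle P false _)
  where
  extended : extend (P ++ false ∷ b ++ true ∷ T) ≡ P ++ false ∷ b ++ true ∷ false ∷ R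
  extended = trans (++-assoc P _ _)
    (cong (λ z → P ++ false ∷ z) (trans (++-assoc b (true ∷ T) _) (cong (λ z → b ++ true ∷ z) padded)))

LexUp-belowPeak : ∀ Q v R R′ → EndsAboveRest Q → DyckPath v → NonpositiveSteps R′ →
  extend (Q ++ false ∷ v ++ false ∷ R) ≡ Q ++ false ∷ v ++ false ∷ R′ →
  LexUp 1 (Q ++ false ∷ v ++ false ∷ R) (Q ++ false ∷ v ++ true ∷ R)
LexUp-belowPeak Q v R R′ aboveRest dv nR′ extended =
  length Q + suc (length v) , j< ,
  trans (bitAt-++ʳ Q _ (suc (length v))) (bitAt-middle v false R) ,
  subst (λ L → rank L (length Q + suc (length v)) ≡ 1) (sym extended) (rank-belowPeak Q v R′ aboveRest dv nR′) ,
  sym (trans (toggle-++ʳ Q _ (suc (length v))) (cong (λ z → Q ++ false ∷ z) (toggle-middle v false R)))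
  where
  j< = length-second-middle Q false v false R

extend-0v0 : ∀ Q v R → extend (Q ++ false ∷ v ++ false ∷ R) ≡
  Q ++ false ∷ v ++ false ∷ (R ++ padding (Q ++ false ∷ v ++ false ∷ R))
extend-0v0 Q v R = trans (++-assoc Q _ _) (cong (λ z → Q ++ false ∷ z) (++-assoc v (false ∷ R) _))

Nonpositive⇒NonpositiveSteps : ∀ {R} → Nonpositive R → NonpositiveSteps R
Nonpositive⇒NonpositiveSteps nR t _ = nR t

extend-at-−1 : ∀ x → height x ≡ -[1+ 0 ] → extend x ≡ x
extend-at-−1 x hx = trans (cong (λ h → x ++ replicate (extra h) false) hx) (++-identityʳ x)

record FlipBijection (n : ℕ) (R : Bits → Bits → Set) (X Y : Bits → Set) : Set where
  field
    flips      : ∀ {a b} → R a b → Σ ℕ λ j → j < length a × b ≡ toggle a j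
    length-X   : ∀ {a} → X a → length a ≡ n
    length-Y   : ∀ {b} → Y b → length b ≡ n
    disjoint   : ∀ {a} → X a → ¬ Y a
    no-return  : ∀ {a b} → Y a → X b → ¬ R a b
    functional : ∀ {a b b′} → R a b → R a b′ → b ≡ b′
    injective  : ∀ {a a′ b} → X a → X a′ → R a b → R a′ b → a ≡ a′
    forward    : ∀ {a} → X a → Σ Bits λ b → R a b × Y b
    backward   : ∀ {b} → Y b → Σ Bits λ a → X a × R a b

perfectMatching : ∀ {n R X Y} → FlipBijection n R X Y →
  PerfectMatching n (Restrict (λ a b → R a b ⊎ R b a) X Y) X Y
perfectMatching {n} {R} {X} {Y} fb = edges , cover
  where
  open FlipBijection fb
  E = Restrict (λ a b → R a b ⊎ R b a) X Y
  length-end : ∀ {a b} → (X a × Y b) ⊎ (Y a × X b) → length a ≡ n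
  length-end (inj₁ (xa , _)) = length-X xa
  length-end (inj₂ (ya , _)) = length-Y ya
  edges : ∀ a b → E a b → QEdge n a b
  edges a b (inj₁ r , ends) with flips r
  ... | j , j< , b≡ = length-end ends , j , subst (j <_) (length-end ends) j< , b≡
  edges a b (inj₂ r , ends) with flips r
  ... | j , j< , refl = length-end ends , j , subst (j <_) (trans (sym (length-toggle b j)) (length-end ends)) j< ,
                        sym (toggle-involutive b j)
  cover : ∀ v → X v ⊎ Y v → Σ Bits λ w → E v w × (∀ w′ → E v w′ → w′ ≡ w)
  cover v (inj₁ xv) with forward xv
  ... | w , r , yw = w , (inj₁ r , inj₁ (xv , yw)) , unique
    where
    unique : ∀ w′ → E v w′ → w′ ≡ w
    unique w′ (inj₁ r′ , inj₁ _)         = functional r′ r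
    unique w′ (inj₂ r′ , inj₁ (_ , yw′)) = ⊥-elim (no-return yw′ xv r′)
    unique w′ (_       , inj₂ (yv , _))  = ⊥-elim (disjoint xv yv)
  cover v (inj₂ yv) with backward yv
  ... | w , xw , r = w , (inj₂ r , inj₂ (yv , xw)) , unique
    where
    unique : ∀ w′ → E v w′ → w′ ≡ w
    unique w′ (_       , inj₁ (xv , _))  = ⊥-elim (disjoint xv yv)
    unique w′ (inj₁ r′ , inj₂ (_ , xw′)) = ⊥-elim (no-return yv xw′ r′)
    unique w′ (inj₂ r′ , inj₂ (_ , xw′)) = injective xw′ xw r′ r

PerfectMatching-swap : ∀ {n E X Y} → PerfectMatching n (Restrict E Y X) Y X → PerfectMatching n (Restrict E X Y) X Y
PerfectMatching-swap (edges , cover) =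
  (λ a b (e , ends) → edges a b (e , swap ends)) ,
  λ v inXY → let (w , (e , ends) , unique) = cover v (swap inXY) in
             w , (e , swap ends) , λ w′ (e′ , ends′) → unique w′ (e′ , swap ends′)

EndsAboveRest-dyck-up : ∀ {p} Q → DyckPath p → + 0 ℤ.≤ height Q → EndsAboveRest Q → EndsAboveRest (p ++ true ∷ Q)
EndsAboveRest-dyck-up {p} Q (hp , np) 0≤hQ aboveRest s s< =
  subst (row (p ++ true ∷ Q) s ℤ.≤_) (sym top) (bound (position p s))
  where
  top : ℤ.pred (height (p ++ true ∷ Q)) ≡ height Q
  top = trans (cong ℤ.pred (trans (height-++ p (true ∷ Q)) (cong (ℤ._+ height (true ∷ Q)) hp))) (pred-up (height Q))
    where
    pred-up : ∀ h → -[1+ 0 ] ℤ.+ (+ 0 ℤ.+ (+ 1 ℤ.+ h)) ≡ h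
    pred-up = solve-∀
  bound : Position p s → row (p ++ true ∷ Q) s ℤ.≤ height Q
  bound (inside s<p)    = subst (ℤ._≤ height Q) (sym (row-++ˡ p _ (ℕP.<⇒≤ s<p))) (ℤP.≤-trans (np s) 0≤hQ)
  bound (beyond zero)    = subst (ℤ._≤ height Q) (sym (trans (row-++ʳ p _ 0) (cong (ℤ._+ + 0) hp))) 0≤hQ
  bound (beyond (suc t)) =
    subst (ℤ._≤ height Q) (sym (trans (row-++ʳ p _ (suc t)) (trans (cong (ℤ._+ row (true ∷ Q) (suc t)) hp) (ℤP.+-identityˡ _))))
      (subst (+ 1 ℤ.+ row Q t ℤ.≤_) (ℤP.suc-pred (height Q)) (ℤP.+-monoʳ-≤ (+ 1) (aboveRest t t<Q)))
    where
    t<Q : t < length Q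
    t<Q = ℕP.≤-pred (ℕP.+-cancelˡ-< (length p) _ _ (subst (length p + suc t <_) (length-++ p) s<))

EndsAboveRest-ups : ∀ {pre} → All DyckPath pre → EndsAboveRest (ups pre)
EndsAboveRest-ups []                   s ()
EndsAboveRest-ups {p ∷ pre} (dp ∷ dps) =
  EndsAboveRest-dyck-up (ups pre) dp (subst (+ 0 ℤ.≤_) (sym (height-ups dps)) (+≤+ z≤n)) (EndsAboveRest-ups dps)

EndsAboveRest⇒EndsAtMax : ∀ {Q} → EndsAboveRest Q → EndsAtMax Q
EndsAboveRest⇒EndsAtMax {Q} aboveRest s with s ℕ.<? length Q
... | yes s< = ℤP.≤-trans (aboveRest s s<) (ℤP.<⇒≤ (ℤP.i≤pred[j]⇒i<j ℤP.≤-refl))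
... | no s≮ = ℤP.≤-reflexive (cong height (take-all s Q (ℕP.≮⇒≥ s≮)))

EndsAtMax-++ : ∀ {P u} → EndsAtMax P → DyckPath u → EndsAtMax (P ++ u)
EndsAtMax-++ {P} {u} atMax (hu , nu) s =
  subst (row (P ++ u) s ℤ.≤_) (sym (trans (height-++ P u) (trans (cong (λ h → height P ℤ.+ h) hu) (ℤP.+-identityʳ _)))) (bound (position P s))
  where
  bound : Position P s → row (P ++ u) s ℤ.≤ height P
  bound (inside s<) = subst (ℤ._≤ height P) (sym (row-++ˡ P u (ℕP.<⇒≤ s<))) (atMax s)
  bound (beyond t)  = subst (ℤ._≤ height P) (sym (row-++ʳ P u t)) (+-nonpos-≤ (height P) (nu t))

EndsAtMax-spine : ∀ {pre u} → All DyckPath pre → DyckPath u → EndsAtMax (ups pre ++ u)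
EndsAtMax-spine dpre du = EndsAtMax-++ (EndsAboveRest⇒EndsAtMax (EndsAboveRest-ups dpre)) du

LexUp-flips : ∀ {p a b} → LexUp p a b → Σ ℕ λ j → j < length a × b ≡ toggle a j
LexUp-flips (j , j< , _ , _ , b≡) = j , j< , b≡

LexUp-length : ∀ {p a b} → LexUp p a b → length b ≡ length a
LexUp-length {a = a} (j , _ , _ , _ , refl) = length-toggle a j

LexUp-height : ∀ {p a b} → LexUp p a b → height b ≡ height a ℤ.+ + 2
LexUp-height {a = a} (j , _ , bit , _ , refl) = height-toggle a j bit

-- The level 2i − h of a decomposition is the height of x, so a flip 0 ↦ 1 raises it by 2 and cannot undo such a raise.
no-flip-back : ∀ {hX iX hY iY a b} → iY + iY + hX ≡ iX + iX + hY + 2 →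
  Decomposition hY iY a → Decomposition hX iX b → ¬ (height b ≡ height a ℤ.+ + 2)
no-flip-back {hX} {iX} {hY} {iY} raise da db hb =
  ℕP.m+1+n≢m (iY + iY + hX) (sym (trans raise (trans (cong (_+ 2) (flip-level da db hb)) (ℕP.+-assoc (iY + iY + hX) 2 2))))

index-unique : ∀ {h i h′ i′ x} → Decomposition h i x → Decomposition h′ i′ x → i ≡ i′
index-unique d d′ = trans (sym (length-pre d)) (trans (cong length (proj₁ (decomposition-unique d d′))) (length-pre d′))

C⁺-C⁻-disjoint : ∀ {n h i h′ i′ x} → C⁺ n h i x → ¬ C⁻ n h′ i′ x
C⁺-C⁻-disjoint x⁺ x⁻ with fromC⁺ x⁺ | fromC⁻ x⁻
... | d , nonempty | d′ , empty = nonempty (trans (proj₁ (proj₂ (decomposition-unique d d′))) empty)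

length-∷ʳ : ∀ {A : Set} (xs : List A) x → length (xs ++ [ x ]) ≡ suc (length xs)
length-∷ʳ xs x = trans (length-++ xs) (ℕP.+-comm (length xs) 1)

compose-∷ʳ : ∀ pre u v post → compose (pre ++ [ u ]) v post ≡ (ups pre ++ u) ++ true ∷ v ++ downs post
compose-∷ʳ pre u v post = begin
  compose (pre ++ [ u ]) v post           ≡⟨ compose-≡ (pre ++ [ u ]) v post ⟩
  ups (pre ++ [ u ]) ++ v ++ downs post   ≡⟨ cong (_++ v ++ downs post) (ups-++ pre [ u ]) ⟩
  (ups pre ++ u ++ [ true ]) ++ v ++ downs post ≡⟨ ++-assoc (ups pre) _ _ ⟩
  ups pre ++ (u ++ [ true ]) ++ v ++ downs post ≡⟨ cong (ups pre ++_) (++-assoc u _ _) ⟩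
  ups pre ++ u ++ true ∷ v ++ downs post  ≡⟨ ++-assoc (ups pre) u _ ⟨
  (ups pre ++ u) ++ true ∷ v ++ downs post ∎
  where open ≡-Reasoning

compose-∷-post : ∀ pre u v post → compose pre u (v ∷ post) ≡ (ups pre ++ u) ++ false ∷ v ++ downs post
compose-∷-post pre u v post = trans (compose-≡ pre u (v ∷ post)) (sym (++-assoc (ups pre) u _))

-- (i): M⁰ moves the first 0-separator into the spine.

LexUp-C-step : ∀ {pre u v post} → All DyckPath pre → DyckPath u → DyckPath v → All DyckPath post →
  LexUp 0 (compose pre u (v ∷ post)) (compose (pre ++ [ u ]) v post)
LexUp-C-step {pre} {u} {v} {post} dpre du dv dpost =
  subst₂ (LexUp 0) (sym (compose-∷-post pre u v post)) (sym (compose-∷ʳ pre u v post))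
    (LexUp-top (ups pre ++ u) (v ++ downs post) (EndsAtMax-spine dpre du) (Nonpositive-++ (proj₂ dv) (Nonpositive-downs dpost)))

module Matching-C (n h i : ℕ) (i<h : i < h) where

  level : ∀ i h → suc i + suc i + h ≡ i + i + h + 2
  level = ℕ-Solver.solve-∀

  Shape : Bits → Set
  Shape a = Σ (List Bits) λ pre → Σ Bits λ u → Σ Bits λ v → Σ (List Bits) λ post →
    a ≡ compose pre u (v ∷ post) × All DyckPath pre × DyckPath u × DyckPath v × All DyckPath post ×
    length pre ≡ i × i + suc (length post) ≡ h

  shape : ∀ {a} → C n h i a → Shape a
  shape xa with fromC xa
  ... | decomposition pre u []         _    _  _            _  i+0≡h _ = ⊥-elim (ℕP.<-irrefl (trans (sym (ℕP.+-identityʳ i)) i+0≡h) i<h)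
  ... | decomposition pre u (v ∷ post) dpre du (dv ∷ dpost) lp lq    x≡ =
    pre , u , v , post , x≡ , dpre , du , dv , dpost , lp , lq

  target : ∀ {a} → Shape a → Bits
  target (pre , u , v , post , _) = compose (pre ++ [ u ]) v post

  step : ∀ {a} (s : Shape a) → LexUp 0 a (target s)
  step (pre , u , v , post , refl , dpre , du , dv , dpost , _) = LexUp-C-step dpre du dv dpost

  forward : ∀ {a} → C n h i a → Σ Bits λ b → LexUp 0 a b × C n h (suc i) b
  forward xa with shape xa
  ... | s@(pre , u , v , post , refl , dpre , du , dv , dpost , lp , lq) =
    target s , step s ,
    toC (trans (LexUp-length (step s)) (proj₁ xa))
      (decomposition (pre ++ [ u ]) v post (AllP.++⁺ dpre (du ∷ [])) dv dpost (trans (length-∷ʳ pre u) (cong suc lp))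
        (trans (sym (ℕP.+-suc i (length post))) lq) refl)

  backward : ∀ {b} → C n h (suc i) b → Σ Bits λ a → C n h i a × LexUp 0 a b
  backward yb with fromC yb
  ... | decomposition pre′ v post dpre′ dv dpost lp lq refl with initLast pre′
  ...   | []          with () ← lp
  ...   | pre ∷ʳ′ u   =
    compose pre u (v ∷ post) ,
    toC (trans (sym (LexUp-length r)) (proj₁ yb))
      (decomposition pre u (v ∷ post) dpre du (dv ∷ dpost) (ℕP.suc-injective (trans (sym (length-∷ʳ pre u)) lp))
        (trans (ℕP.+-suc i (length post)) lq) refl) ,
    r
    where
    dpre = AllP.++⁻ˡ pre dpre′
    du = All.head (AllP.++⁻ʳ pre dpre′)
    r = LexUp-C-step dpre du dv dpost

  injective : ∀ {a a′ b} → C n h i a → C n h i a′ → LexUp 0 a b → LexUp 0 a′ b → a ≡ a′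
  injective xa xa′ r r′ with shape xa | shape xa′
  ... | s@(pre , u , v , post , refl , dpre , du , dv , dpost , _) | s′@(pre′ , u′ , v′ , post′ , refl , dpre′ , du′ , dv′ , dpost′ , _)
    with compose-injective (AllP.++⁺ dpre (du ∷ [])) dv dpost (AllP.++⁺ dpre′ (du′ ∷ [])) dv′ dpost′
           (trans (LexUp-functional (step s) r) (LexUp-functional r′ (step s′)))
  ... | pre++u≡ , refl , refl with ∷ʳ-injective pre pre′ pre++u≡
  ... | refl , refl = refl

  perfect :
    PerfectMatching n (Restrict (Mlex 0) (C n h i) (C n h (suc i))) (C n h i) (C n h (suc i))
  perfect = perfectMatching record
    { flips      = LexUp-flips
    ; length-X   = proj₁
    ; length-Y   = proj₁
    ; disjoint   = λ xa ya → ℕP.1+n≢n (sym (index-unique (fromC xa) (fromC ya)))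
    ; no-return  = λ ya xb r → no-flip-back (level i h) (fromC ya) (fromC xb) (LexUp-height r)
    ; functional = LexUp-functional
    ; injective  = injective
    ; forward    = forward
    ; backward   = backward
    }

-- (ii), first matching: 0 a 0 b 1 ↦ 0 a 1 b 1.

NonpositiveSteps-∷ʳ : ∀ {b} c → Nonpositive b → NonpositiveSteps (b ++ [ c ])
NonpositiveSteps-∷ʳ {b} c nb t t< =
  subst (ℤ._≤ + 0) (sym (row-++ˡ b [ c ] (ℕP.≤-pred (subst (t <_) (length-∷ʳ b c) t<)))) (nb t)

LexUp-C⁻₁₀ : ∀ {a b} → DyckPath a → DyckPath b →
  LexUp 1 (compose [] [] [ a ++ false ∷ b ++ [ true ] ]) (compose [ false ∷ a ++ true ∷ b ] [] [])
LexUp-C⁻₁₀ {a} {b} da db =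
  subst₂ (LexUp 1) (cong (false ∷_) (sym (++-identityʳ w))) (cong (false ∷_) (sym (++-assoc a (true ∷ b) [ true ])))
    (LexUp-belowPeak [] a R R (λ _ ()) da (NonpositiveSteps-∷ʳ true (proj₂ db)) (extend-at-−1 x hx))
  where
  R = b ++ [ true ]
  w = a ++ false ∷ R
  x = false ∷ w
  hx : height x ≡ -[1+ 0 ]
  hx = cong (λ h → -[1+ 0 ] ℤ.+ h) (proj₁ (DyckPath-a0b1 da db))

module Matching-C⁻₁₀ (n : ℕ) (3≤n : 3 ≤ n) where

  length≢1 : ∀ {x : Bits} → length x ≡ n → length x ≢ 1
  length≢1 len one with ℕP.≤-trans 3≤n (ℕP.≤-reflexive (trans (sym len) one))
  ... | s≤s ()

  Shape : Bits → Set
  Shape x = Σ Bits λ a → Σ Bits λ b → x ≡ compose [] [] [ a ++ false ∷ b ++ [ true ] ] × DyckPath a × DyckPath b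

  shape : ∀ {x} → C⁻ n 1 0 x → Shape x
  shape {x} x⁻ with fromC⁻ x⁻
  ... | decomposition [] .[] []          _ _ _ _ () _ , refl
  ... | decomposition [] .[] (_ ∷ _ ∷ _) _ _ _ _ () _ , refl
  ... | decomposition [] .[] (w ∷ [])    [] _ (dw ∷ []) refl refl refl , refl
    with split-a0b1 w dw (λ w≡[] → length≢1 {compose [] [] [ w ]} (proj₁ x⁻) (cong (λ w → length (compose [] [] [ w ])) w≡[]))
  ... | a , b , refl , da , db = a , b , refl , da , db

  target : ∀ {x} → Shape x → Bits
  target (a , b , _) = compose [ false ∷ a ++ true ∷ b ] [] []

  step : ∀ {x} (s : Shape x) → LexUp 1 x (target s)
  step (a , b , refl , da , db) = LexUp-C⁻₁₀ da db

  forward : ∀ {x} → C⁻ n 1 0 x → Σ Bits λ y → LexUp 1 x y × C⁻ n 1 1 y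
  forward x⁻ with shape x⁻
  ... | s@(a , b , refl , da , db) =
    target s , step s ,
    toC⁻ (trans (LexUp-length (step s)) (proj₁ x⁻)) (decomposition _ [] [] (DyckPath-0v1w da db ∷ []) DyckPath-[] [] refl refl refl) refl

  backward : ∀ {y} → C⁻ n 1 1 y → Σ Bits λ x → C⁻ n 1 0 x × LexUp 1 x y
  backward y⁻ with fromC⁻ y⁻
  ... | decomposition (p ∷ []) .[] [] (dp ∷ []) _ [] refl refl refl , refl
    with split-0v1w p dp (λ p≡[] → length≢1 {compose [ p ] [] []} (proj₁ y⁻) (cong (λ p → length (compose [ p ] [] [])) p≡[]))
  ... | a , b , refl , da , db =
    _ , toC⁻ (trans (sym (LexUp-length r)) (proj₁ y⁻)) (decomposition [] [] _ [] DyckPath-[] (DyckPath-a0b1 da db ∷ []) refl refl refl) refl , r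
    where
    r = LexUp-C⁻₁₀ da db

  injective : ∀ {x x′ y} → C⁻ n 1 0 x → C⁻ n 1 0 x′ → LexUp 1 x y → LexUp 1 x′ y → x ≡ x′
  injective x⁻ x′⁻ r r′ with shape x⁻ | shape x′⁻
  ... | s@(a , b , refl , da , db) | s′@(a′ , b′ , refl , da′ , db′)
    with compose-injective (DyckPath-0v1w da db ∷ []) DyckPath-[] [] (DyckPath-0v1w da′ db′ ∷ []) DyckPath-[] []
           (trans (LexUp-functional (step s) r) (LexUp-functional r′ (step s′)))
  ... | eq , _ with 0v1w-injective da da′ (proj₁ (∷-injective eq))
  ... | refl , refl = refl

  perfect :
    PerfectMatching n (Restrict (Mlex 1) (C⁻ n 1 0) (C⁻ n 1 1)) (C⁻ n 1 0) (C⁻ n 1 1)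
  perfect = perfectMatching record
    { flips      = LexUp-flips
    ; length-X   = proj₁
    ; length-Y   = proj₁
    ; disjoint   = λ xa ya → ℕP.0≢1+n (index-unique (proj₁ (fromC⁻ xa)) (proj₁ (fromC⁻ ya)))
    ; no-return  = λ ya xb r → no-flip-back refl (proj₁ (fromC⁻ ya)) (proj₁ (fromC⁻ xb)) (LexUp-height r)
    ; functional = LexUp-functional
    ; injective  = injective
    ; forward    = forward
    ; backward   = backward
    }

-- (ii), second matching: u_i = a 0 b 1 ↦ u_i, u_{i+1}, u_{i+2} = a, b, ε.

padding-after-downs : ∀ x {pre u post} → All DyckPath pre → DyckPath u → All DyckPath post → x ≡ compose pre u post →
  Σ Bits λ R → Nonpositive R × downs post ++ padding x ≡ false ∷ R
padding-after-downs x {post = v ∷ post} dpre du (dv ∷ dpost) _ =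
  _ , Nonpositive-padding x (Nonpositive-++ (proj₂ dv) (Nonpositive-downs dpost)) , refl
padding-after-downs x {pre} {post = []} dpre du [] refl =
  _ , Nonpositive-replicate (length pre) ,
  padding-nonneg x (trans (height-compose dpre du []) (ℤP.+-identityʳ (+ length pre)))

compose-a0b1 : ∀ pre a b post → compose pre (a ++ false ∷ b ++ [ true ]) post ≡ (ups pre ++ a) ++ false ∷ b ++ true ∷ downs post
compose-a0b1 pre a b post = begin
  compose pre (a ++ false ∷ b ++ [ true ]) post           ≡⟨ compose-≡ pre _ post ⟩
  ups pre ++ (a ++ false ∷ b ++ [ true ]) ++ downs post   ≡⟨ cong (ups pre ++_) (++-assoc a _ _) ⟩
  ups pre ++ a ++ false ∷ (b ++ [ true ]) ++ downs post   ≡⟨ cong (λ z → ups pre ++ a ++ false ∷ z) (++-assoc b _ _) ⟩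
  ups pre ++ a ++ false ∷ b ++ true ∷ downs post          ≡⟨ ++-assoc (ups pre) a _ ⟨
  (ups pre ++ a) ++ false ∷ b ++ true ∷ downs post        ∎
  where open ≡-Reasoning

compose-spine-ab : ∀ pre a b post → compose (pre ++ a ∷ b ∷ []) [] post ≡ (ups pre ++ a) ++ true ∷ b ++ true ∷ downs post
compose-spine-ab pre a b post = begin
  compose (pre ++ a ∷ b ∷ []) [] post                    ≡⟨ compose-≡ (pre ++ a ∷ b ∷ []) [] post ⟩
  ups (pre ++ a ∷ b ∷ []) ++ downs post                  ≡⟨ cong (_++ downs post) (ups-++ pre (a ∷ b ∷ [])) ⟩
  (ups pre ++ a ++ true ∷ b ++ true ∷ []) ++ downs post  ≡⟨ ++-assoc (ups pre) _ _ ⟩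
  ups pre ++ (a ++ true ∷ b ++ true ∷ []) ++ downs post  ≡⟨ cong (ups pre ++_) (++-assoc a _ _) ⟩
  ups pre ++ a ++ true ∷ (b ++ true ∷ []) ++ downs post  ≡⟨ cong (λ z → ups pre ++ a ++ true ∷ z) (++-assoc b _ _) ⟩
  ups pre ++ a ++ true ∷ b ++ true ∷ downs post          ≡⟨ ++-assoc (ups pre) a _ ⟨
  (ups pre ++ a) ++ true ∷ b ++ true ∷ downs post        ∎
  where open ≡-Reasoning

LexUp-C⁺-split : ∀ {pre a b post} → All DyckPath pre → DyckPath a → DyckPath b → All DyckPath post →
  LexUp 1 (compose pre (a ++ false ∷ b ++ [ true ]) post) (compose (pre ++ a ∷ b ∷ []) [] post)
LexUp-C⁺-split {pre} {a} {b} {post} dpre da db dpost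
  with padding-after-downs (compose pre (a ++ false ∷ b ++ [ true ]) post) dpre (DyckPath-a0b1 da db) dpost refl
... | R , nR , padded =
  subst₂ (LexUp 1) (sym (compose-a0b1 pre a b post)) (sym (compose-spine-ab pre a b post))
    (LexUp-second (ups pre ++ a) b (downs post) R (EndsAtMax-spine dpre da) db nR
      (subst (λ x → downs post ++ padding x ≡ false ∷ R) (compose-a0b1 pre a b post) padded))

module Matching-C⁺-C⁻-up (n h i : ℕ) where

  level : ∀ i h → i + 2 + (i + 2) + h ≡ i + i + (h + 2) + 2
  level = ℕ-Solver.solve-∀

  shift : ∀ i p → i + 2 + p ≡ i + p + 2
  shift = ℕ-Solver.solve-∀

  lengths : ∀ p → i + p ≡ h → i + 2 + p ≡ h + 2
  lengths p eq = trans (shift i p) (cong (_+ 2) eq)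

  length-pre₂ : ∀ (pre : List Bits) a b → length (pre ++ a ∷ b ∷ []) ≡ length pre + 2
  length-pre₂ pre a b = length-++ pre

  Shape : Bits → Set
  Shape x = Σ (List Bits) λ pre → Σ Bits λ a → Σ Bits λ b → Σ (List Bits) λ post →
    x ≡ compose pre (a ++ false ∷ b ++ [ true ]) post × All DyckPath pre × DyckPath a × DyckPath b × All DyckPath post ×
    length pre ≡ i × i + length post ≡ h

  shape : ∀ {x} → C⁺ n h i x → Shape x
  shape x⁺ with fromC⁺ x⁺
  ... | decomposition pre u post dpre du dpost lp lq refl , nonempty with split-a0b1 u du nonempty
  ... | a , b , refl , da , db = pre , a , b , post , refl , dpre , da , db , dpost , lp , lq

  target : ∀ {x} → Shape x → Bits
  target (pre , a , b , post , _) = compose (pre ++ a ∷ b ∷ []) [] post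

  step : ∀ {x} (s : Shape x) → LexUp 1 x (target s)
  step (_ , _ , _ , _ , refl , dpre , da , db , dpost , _) = LexUp-C⁺-split dpre da db dpost

  forward : ∀ {x} → C⁺ n h i x → Σ Bits λ y → LexUp 1 x y × C⁻ n (h + 2) (i + 2) y
  forward x⁺ with shape x⁺
  ... | s@(pre , a , b , post , refl , dpre , da , db , dpost , lp , lq) =
    target s , step s ,
    toC⁻ (trans (LexUp-length (step s)) (proj₁ x⁺))
      (decomposition (pre ++ a ∷ b ∷ []) [] post (AllP.++⁺ dpre (da ∷ db ∷ [])) DyckPath-[] dpost
        (trans (length-pre₂ pre a b) (cong (_+ 2) lp)) (lengths (length post) lq) refl) refl

  backward : ∀ {y} → C⁻ n (h + 2) (i + 2) y → Σ Bits λ x → C⁺ n h i x × LexUp 1 x y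
  backward y⁻ with fromC⁻ y⁻
  ... | decomposition pre₂ .[] post dpre₂ _ dpost lp lq refl , refl with initLast pre₂
  ... | [] with () ← trans lp (ℕP.+-comm i 2)
  ... | pre₁ ∷ʳ′ b with initLast pre₁
  ... | [] with () ← ℕP.suc-injective (trans (sym (length-∷ʳ [] b)) (trans lp (ℕP.+-comm i 2)))
  ... | pre ∷ʳ′ a rewrite ++-assoc pre [ a ] [ b ] =
    compose pre (a ++ false ∷ b ++ [ true ]) post ,
    toC⁺ (trans (sym (LexUp-length r)) (proj₁ y⁻))
      (decomposition pre _ post dpre (DyckPath-a0b1 da db) dpost
        (ℕP.+-cancelʳ-≡ 2 (length pre) i (trans (sym (length-pre₂ pre a b)) lp))
        (ℕP.+-cancelʳ-≡ 2 _ _ (trans (sym (shift i (length post))) lq)) refl)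
      (++-∷-≢[] a _) ,
    r
    where
    dpre = AllP.++⁻ˡ pre dpre₂
    da = All.head (AllP.++⁻ʳ pre dpre₂)
    db = All.head (All.tail (AllP.++⁻ʳ pre dpre₂))
    r = LexUp-C⁺-split dpre da db dpost

  injective : ∀ {x x′ y} → C⁺ n h i x → C⁺ n h i x′ → LexUp 1 x y → LexUp 1 x′ y → x ≡ x′
  injective x⁺ x′⁺ r r′ with shape x⁺ | shape x′⁺
  ... | s@(pre , a , b , post , refl , dpre , da , db , dpost , _) | s′@(pre′ , a′ , b′ , post′ , refl , dpre′ , da′ , db′ , dpost′ , _)
    with compose-injective (AllP.++⁺ dpre (da ∷ db ∷ [])) DyckPath-[] dpost (AllP.++⁺ dpre′ (da′ ∷ db′ ∷ [])) DyckPath-[] dpost′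
           (trans (LexUp-functional (step s) r) (LexUp-functional r′ (step s′)))
  ... | pre₂≡ , _ , refl
    with ∷ʳ-injective (pre ++ [ a ]) (pre′ ++ [ a′ ]) (trans (++-assoc pre [ a ] [ b ]) (trans pre₂≡ (sym (++-assoc pre′ [ a′ ] [ b′ ]))))
  ... | pre₁≡ , refl with ∷ʳ-injective pre pre′ pre₁≡
  ... | refl , refl = refl

  perfect :
    PerfectMatching n (Restrict (Mlex 1) (C⁺ n h i) (C⁻ n (h + 2) (i + 2))) (C⁺ n h i) (C⁻ n (h + 2) (i + 2))
  perfect = perfectMatching record
    { flips      = LexUp-flips
    ; length-X   = proj₁
    ; length-Y   = proj₁
    ; disjoint   = C⁺-C⁻-disjoint
    ; no-return  = λ ya xb r → no-flip-back (level i h) (proj₁ (fromC⁻ ya)) (proj₁ (fromC⁺ xb)) (LexUp-height r)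
    ; functional = LexUp-functional
    ; injective  = injective
    ; forward    = forward
    ; backward   = backward
    }

-- (ii), third matching: u_i, u_{i+1}, u_{i+2} = ε, v, w ↦ u_i = 0 v 1 w.

LexUp-C⁻-merge : ∀ {pre v w post} → All DyckPath pre → DyckPath v → DyckPath w → All DyckPath post →
  LexUp 1 (compose pre [] (v ∷ w ∷ post)) (compose pre (false ∷ v ++ true ∷ w) post)
LexUp-C⁻-merge {pre} {v} {w} {post} dpre dv dw dpost =
  subst₂ (LexUp 1) (sym (compose-≡ pre [] (v ∷ w ∷ post))) merged
    (LexUp-belowPeak (ups pre) v R (R ++ padding x) (EndsAboveRest-ups dpre) dv
      (Nonpositive⇒NonpositiveSteps (Nonpositive-padding x (Nonpositive-++ (proj₂ dw) (Nonpositive-downs dpost))))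
      (extend-0v0 (ups pre) v R))
  where
  R = w ++ downs post
  x = ups pre ++ false ∷ v ++ false ∷ R
  merged : ups pre ++ false ∷ v ++ true ∷ R ≡ compose pre (false ∷ v ++ true ∷ w) post
  merged = trans (cong (λ z → ups pre ++ false ∷ z) (sym (++-assoc v (true ∷ w) (downs post)))) (sym (compose-≡ pre _ post))

module Matching-C⁺-C⁻-same (n h i : ℕ) (i≤h : i ≤ h) where

  level : ∀ i h → i + i + (h + 2) ≡ i + i + h + 2
  level = ℕ-Solver.solve-∀

  shift : ∀ i p → i + suc (suc p) ≡ i + p + 2
  shift = ℕ-Solver.solve-∀

  lengths : ∀ p → i + suc (suc p) ≡ h + 2 → i + p ≡ h
  lengths p eq = ℕP.+-cancelʳ-≡ 2 _ _ (trans (sym (shift i p)) eq)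

  two≤ : ∀ k → i + k ≡ h + 2 → 2 ≤ k
  two≤ k eq = ℕP.+-cancelˡ-≤ h 2 k (subst (_≤ h + k) eq (ℕP.+-monoˡ-≤ k i≤h))

  Shape : Bits → Set
  Shape x = Σ (List Bits) λ pre → Σ Bits λ v → Σ Bits λ w → Σ (List Bits) λ post →
    x ≡ compose pre [] (v ∷ w ∷ post) × All DyckPath pre × DyckPath v × DyckPath w × All DyckPath post ×
    length pre ≡ i × i + length post ≡ h

  shape : ∀ {x} → C⁻ n (h + 2) i x → Shape x
  shape x⁻ with fromC⁻ x⁻
  ... | decomposition pre .[] []       _ _ _ _ lq _ , refl with () ← two≤ 0 lq
  ... | decomposition pre .[] (v ∷ []) _ _ _ _ lq _ , refl with s≤s () ← two≤ 1 lq
  ... | decomposition pre .[] (v ∷ w ∷ post) dpre _ (dv ∷ dw ∷ dpost) lp lq refl , refl =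
    pre , v , w , post , refl , dpre , dv , dw , dpost , lp , lengths (length post) lq

  target : ∀ {x} → Shape x → Bits
  target (pre , v , w , post , _) = compose pre (false ∷ v ++ true ∷ w) post

  step : ∀ {x} (s : Shape x) → LexUp 1 x (target s)
  step (_ , _ , _ , _ , refl , dpre , dv , dw , dpost , _) = LexUp-C⁻-merge dpre dv dw dpost

  forward : ∀ {x} → C⁻ n (h + 2) i x → Σ Bits λ y → LexUp 1 x y × C⁺ n h i y
  forward x⁻ with shape x⁻
  ... | s@(pre , v , w , post , refl , dpre , dv , dw , dpost , lp , lq) =
    target s , step s ,
    toC⁺ (trans (LexUp-length (step s)) (proj₁ x⁻)) (decomposition pre _ post dpre (DyckPath-0v1w dv dw) dpost lp lq refl) (λ ())

  backward : ∀ {y} → C⁺ n h i y → Σ Bits λ x → C⁻ n (h + 2) i x × LexUp 1 x y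
  backward y⁺ with fromC⁺ y⁺
  ... | decomposition pre u post dpre du dpost lp lq refl , nonempty with split-0v1w u du nonempty
  ... | v , w , refl , dv , dw =
    compose pre [] (v ∷ w ∷ post) ,
    toC⁻ (trans (sym (LexUp-length r)) (proj₁ y⁺))
      (decomposition pre [] (v ∷ w ∷ post) dpre DyckPath-[] (dv ∷ dw ∷ dpost) lp (trans (shift i (length post)) (cong (_+ 2) lq)) refl) refl ,
    r
    where
    r = LexUp-C⁻-merge dpre dv dw dpost

  injective : ∀ {x x′ y} → C⁻ n (h + 2) i x → C⁻ n (h + 2) i x′ → LexUp 1 x y → LexUp 1 x′ y → x ≡ x′
  injective x⁻ x′⁻ r r′ with shape x⁻ | shape x′⁻
  ... | s@(pre , v , w , post , refl , dpre , dv , dw , dpost , _) | s′@(pre′ , v′ , w′ , post′ , refl , dpre′ , dv′ , dw′ , dpost′ , _)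
    with compose-injective dpre (DyckPath-0v1w dv dw) dpost dpre′ (DyckPath-0v1w dv′ dw′) dpost′
           (trans (LexUp-functional (step s) r) (LexUp-functional r′ (step s′)))
  ... | refl , u≡ , refl with 0v1w-injective dv dv′ u≡
  ... | refl , refl = refl

  perfect :
    PerfectMatching n (Restrict (Mlex 1) (C⁺ n h i) (C⁻ n (h + 2) i)) (C⁺ n h i) (C⁻ n (h + 2) i)
  perfect = PerfectMatching-swap (perfectMatching record
    { flips      = LexUp-flips
    ; length-X   = proj₁
    ; length-Y   = proj₁
    ; disjoint   = λ x⁻ x⁺ → C⁺-C⁻-disjoint x⁺ x⁻
    ; no-return  = λ ya xb r → no-flip-back (level i h) (proj₁ (fromC⁺ ya)) (proj₁ (fromC⁻ xb)) (LexUp-height r)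
    ; functional = LexUp-functional
    ; injective  = injective
    ; forward    = forward
    ; backward   = backward
    })

-- (iii): z(x) for x ∈ C⁻_{h,i}, expressed through decompositions

Rot-functional : ∀ {u r r′} → Rot u r → Rot u r′ → r ≡ r′
Rot-functional (inj₁ (_ , refl)) (inj₁ (_ , refl)) = refl
Rot-functional (inj₁ (refl , _)) (inj₂ (_ , _ , _ , _ , () , _))
Rot-functional (inj₂ (_ , _ , _ , _ , () , _)) (inj₁ (refl , _))
Rot-functional (inj₂ (v , w , dv , _ , refl , refl)) (inj₂ (v′ , w′ , dv′ , _ , eq , refl))
  with 0v1w-injective (Dyck⇒DyckPath dv) (Dyck⇒DyckPath dv′) eq
... | refl , refl = refl

Rot-injective : ∀ {u u′ r} → Rot u r → Rot u′ r → u ≡ u′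
Rot-injective (inj₁ (refl , _)) (inj₁ (refl , _)) = refl
Rot-injective (inj₁ (_ , refl)) (inj₂ (v , _ , _ , _ , _ , eq)) = ⊥-elim (++-∷-≢[] v _ (sym eq))
Rot-injective (inj₂ (v , _ , _ , _ , _ , eq)) (inj₁ (_ , refl)) = ⊥-elim (++-∷-≢[] v _ (sym eq))
Rot-injective (inj₂ (v , w , dv , dw , refl , refl)) (inj₂ (v′ , w′ , dv′ , dw′ , refl , eq))
  with a0b1-injective (Dyck⇒DyckPath dv) (Dyck⇒DyckPath dw) (Dyck⇒DyckPath dv′) (Dyck⇒DyckPath dw′) eq
... | refl , refl = refl

Rot-DyckPath : ∀ {u r} → Rot u r → DyckPath r
Rot-DyckPath (inj₁ (_ , refl))                   = DyckPath-[]
Rot-DyckPath (inj₂ (_ , _ , dv , dw , _ , refl)) = DyckPath-a0b1 (Dyck⇒DyckPath dv) (Dyck⇒DyckPath dw)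

rot : ∀ {u} → DyckPath u → Σ Bits λ r → Rot u r
rot {[]}    _  = [] , inj₁ (refl , refl)
rot {c ∷ u} du with split-0v1w (c ∷ u) du (λ ())
... | v , w , eq , dv , dw = _ , inj₂ (v , w , DyckPath⇒Dyck dv , DyckPath⇒Dyck dw , eq , refl)

rot⁻¹ : ∀ {r} → DyckPath r → Σ Bits λ u → Rot u r × DyckPath u
rot⁻¹ {[]}    _  = [] , inj₁ (refl , refl) , DyckPath-[]
rot⁻¹ {c ∷ r} dr with split-a0b1 (c ∷ r) dr (λ ())
... | a , b , eq , da , db = _ , inj₂ (a , b , DyckPath⇒Dyck da , DyckPath⇒Dyck db , refl , eq) , DyckPath-0v1w da db

take-length-++ : ∀ {A : Set} (xs ys : List A) → take (length xs) (xs ++ ys) ≡ xs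
take-length-++ []       ys = refl
take-length-++ (x ∷ xs) ys = cong (x ∷_) (take-length-++ xs ys)

drop-2+length-++ : ∀ {A : Set} (xs : List A) a b ys → drop (suc (suc (length xs))) (xs ++ a ∷ b ∷ ys) ≡ ys
drop-2+length-++ []       a b ys = refl
drop-2+length-++ (x ∷ xs) a b ys = drop-2+length-++ xs a b ys

concatMap-∷ʳ-true : ∀ pre → concatMap (λ u → u ++ [ true ]) pre ≡ ups pre
concatMap-∷ʳ-true []        = refl
concatMap-∷ʳ-true (u ∷ pre) = trans (++-assoc u [ true ] _) (cong (λ z → u ++ true ∷ z) (concatMap-∷ʳ-true pre))

zForm-compose : ∀ pre u′ v post r →
  zForm (suc (length pre)) ((pre ++ [ u′ ]) ++ [] ∷ v ∷ post) r ≡ compose pre [] (r ∷ v ∷ post)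
zForm-compose pre u′ v post r rewrite ++-assoc pre [ u′ ] ([] ∷ v ∷ post) =
  trans (cong₂ (λ A B → A ++ false ∷ r ++ false ∷ B)
          (trans (cong (concatMap (λ u → u ++ [ true ])) (take-length-++ pre _)) (concatMap-∷ʳ-true pre))
          (trans (cong (assemble 0) (drop-2+length-++ pre u′ [] (v ∷ post))) (cong (v ++_) (glue-0 post))))
    (sym (compose-≡ pre [] (r ∷ v ∷ post)))

nth-∷ʳ : ∀ pre (u′ : Bits) rest → nth ((pre ++ [ u′ ]) ++ rest) (length pre) ≡ u′
nth-∷ʳ pre u′ rest = trans (cong (λ us → nth us (length pre)) (++-assoc pre [ u′ ] rest)) (nth-middle pre u′ rest)

Rot-toggle : ∀ pre {u′ r} post → Rot u′ r →
  Σ ℕ λ j → j < length (compose (pre ++ [ u′ ]) [] post) × compose pre [] (r ∷ post) ≡ toggle (compose (pre ++ [ u′ ]) [] post) j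
Rot-toggle pre post (inj₁ (refl , refl)) =
  length (ups pre ++ []) ,
  subst (λ x → length (ups pre ++ []) < length x) (sym (compose-∷ʳ pre [] [] post)) (length-middle (ups pre ++ []) true _) ,
  sym (begin
    toggle (compose (pre ++ [ [] ]) [] post) (length (ups pre ++ [])) ≡⟨ cong (λ x → toggle x _) (compose-∷ʳ pre [] [] post) ⟩
    toggle ((ups pre ++ []) ++ true ∷ downs post) (length (ups pre ++ [])) ≡⟨ toggle-middle (ups pre ++ []) true _ ⟩
    (ups pre ++ []) ++ false ∷ downs post ≡⟨ cong (_++ false ∷ downs post) (++-identityʳ (ups pre)) ⟩
    ups pre ++ false ∷ downs post ≡⟨ compose-≡ pre [] ([] ∷ post) ⟨
    compose pre [] ([] ∷ post) ∎)
  where open ≡-Reasoning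
Rot-toggle pre post (inj₂ (v , w , _ , _ , refl , refl)) =
  length (ups pre) + suc (length v) ,
  subst (λ x → length (ups pre) + suc (length v) < length x) (sym x≡) (length-second-middle (ups pre) false v true _) ,
  sym (begin
    toggle (compose (pre ++ [ u′ ]) [] post) j ≡⟨ cong (λ x → toggle x j) x≡ ⟩
    toggle (ups pre ++ false ∷ v ++ true ∷ T) j ≡⟨ toggle-++ʳ (ups pre) _ (suc (length v)) ⟩
    ups pre ++ false ∷ toggle (v ++ true ∷ T) (length v) ≡⟨ cong (λ z → ups pre ++ false ∷ z) (toggle-middle v true T) ⟩
    ups pre ++ false ∷ v ++ false ∷ w ++ true ∷ downs post ≡⟨ cong (λ z → ups pre ++ false ∷ z) (sym (++-assoc v _ _)) ⟩
    ups pre ++ false ∷ (v ++ false ∷ w) ++ true ∷ downs post ≡⟨ cong (λ z → ups pre ++ false ∷ z) (sym (++-assoc (v ++ false ∷ w) _ _)) ⟩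
    ups pre ++ false ∷ ((v ++ false ∷ w) ++ [ true ]) ++ downs post ≡⟨ cong (λ z → ups pre ++ false ∷ z ++ downs post) (++-assoc v _ _) ⟩
    ups pre ++ false ∷ (v ++ false ∷ w ++ [ true ]) ++ downs post ≡⟨ compose-≡ pre [] (_ ∷ post) ⟨
    compose pre [] ((v ++ false ∷ w ++ [ true ]) ∷ post) ∎)
  where
  open ≡-Reasoning
  u′ = false ∷ v ++ true ∷ w
  T = w ++ true ∷ downs post
  j = length (ups pre) + suc (length v)
  x≡ : compose (pre ++ [ u′ ]) [] post ≡ ups pre ++ false ∷ v ++ true ∷ T
  x≡ = trans (compose-∷ʳ pre u′ [] post)
    (trans (++-assoc (ups pre) u′ _) (cong (λ z → ups pre ++ false ∷ z) (++-assoc v (true ∷ w) _)))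

record ZStep (h k : ℕ) (x y : Bits) : Set where
  constructor zStep
  field
    pre        : List Bits
    u′         : Bits
    v          : Bits
    post       : List Bits
    r          : Bits
    pre-dyck   : All DyckPath pre
    u′-dyck    : DyckPath u′
    v-dyck     : DyckPath v
    post-dyck  : All DyckPath post
    rotation   : Rot u′ r
    length-pre : length pre ≡ k
    lengths    : suc k + suc (length post) ≡ h
    x≡         : x ≡ compose (pre ++ [ u′ ]) [] (v ∷ post)
    y≡         : y ≡ compose pre [] (r ∷ v ∷ post)

ZUp-intro : ∀ {n h pre u′ v post r} → All DyckPath pre → DyckPath u′ → DyckPath v → All DyckPath post → Rot u′ r →
  suc (length pre) + suc (length post) ≡ h → length (compose (pre ++ [ u′ ]) [] (v ∷ post)) ≡ n →
  ZUp n h (suc (length pre)) (compose (pre ++ [ u′ ]) [] (v ∷ post)) (compose pre [] (r ∷ v ∷ post))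
ZUp-intro {h = h} {pre} {u′} {v} {post} {r} dpre du′ dv dpost rotation lengths len =
  len , _ , Decomposition⇒Decomp d , nth-decomposition d , r ,
  subst (λ u → Rot u r) (sym (nth-∷ʳ pre u′ ([] ∷ v ∷ post))) rotation ,
  sym (zForm-compose pre u′ v post r)
  where
  d : Decomposition h (suc (length pre)) (compose (pre ++ [ u′ ]) [] (v ∷ post))
  d = decomposition (pre ++ [ u′ ]) [] (v ∷ post) (AllP.++⁺ dpre (du′ ∷ [])) DyckPath-[] (dv ∷ dpost)
        (length-∷ʳ pre u′) lengths refl

ZUp-shape : ∀ {n h k x y} → suc k < h → ZUp n h (suc k) x y → ZStep h k x y
ZUp-shape {h = h} {k} {x} {y} k<h (_ , _ , dec , empty , r , rotation , y≡) with Decomp⇒Decomposition dec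
... | d , refl = shape d (trans (sym (nth-decomposition d)) empty) rotation y≡
  where
  shape : (d : Decomposition h (suc k) x) → u d ≡ [] → Rot (nth (pre d ++ u d ∷ post d) k) r →
    y ≡ zForm (suc k) (pre d ++ u d ∷ post d) r → ZStep h k x y
  shape (decomposition pre′ .[] post dpre′ _ dpost lp lq x≡) refl rotation y≡ with initLast pre′ | post
  ... | []         | _ with () ← lp
  ... | pre ∷ʳ′ u′ | [] = ⊥-elim (ℕP.<-irrefl (trans (sym (ℕP.+-identityʳ (suc k))) lq) k<h)
  ... | pre ∷ʳ′ u′ | v ∷ post′ with refl ← ℕP.suc-injective (trans (sym (length-∷ʳ pre u′)) lp) =
    zStep pre u′ v post′ r (AllP.++⁻ˡ pre dpre′) (All.head (AllP.++⁻ʳ pre dpre′)) (All.head dpost) (All.tail dpost)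
      (subst (λ u → Rot u r) (nth-∷ʳ pre u′ ([] ∷ v ∷ post′)) rotation) refl lq x≡
      (trans y≡ (zForm-compose pre u′ v post′ r))

module Matching-Z (n h k : ℕ) (k<h : suc k < h) where

  disjoint : ∀ {a} → C⁻ n h (suc k) a → ¬ C⁻ n h k a
  disjoint xa ya = ℕP.1+n≢n (index-unique (proj₁ (fromC⁻ xa)) (proj₁ (fromC⁻ ya)))

  flips : ∀ {a b} → ZUp n h (suc k) a b → Σ ℕ λ j → j < length a × b ≡ toggle a j
  flips z with ZUp-shape k<h z
  ... | zStep pre u′ v post r _ _ _ _ rotation _ _ refl refl = Rot-toggle pre (v ∷ post) rotation

  length-image : ∀ {a b} → ZUp n h (suc k) a b → length b ≡ length a
  length-image {a} z with flips z
  ... | j , _ , refl = length-toggle a j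

  functional : ∀ {a b b′} → ZUp n h (suc k) a b → ZUp n h (suc k) a b′ → b ≡ b′
  functional z z′ with ZUp-shape k<h z | ZUp-shape k<h z′
  ... | zStep pre u′ v post r dpre du′ dv dpost rotation _ _ refl refl
      | zStep pre″ u″ v″ post″ r″ dpre″ du″ dv″ dpost″ rotation″ _ _ x≡ refl
    with compose-injective (AllP.++⁺ dpre (du′ ∷ [])) DyckPath-[] (dv ∷ dpost)
           (AllP.++⁺ dpre″ (du″ ∷ [])) DyckPath-[] (dv″ ∷ dpost″) x≡
  ... | pre≡ , _ , refl with ∷ʳ-injective pre pre″ pre≡
  ... | refl , refl with refl ← Rot-functional rotation rotation″ = refl

  injective : ∀ {a a′ b} → C⁻ n h (suc k) a → C⁻ n h (suc k) a′ → ZUp n h (suc k) a b → ZUp n h (suc k) a′ b → a ≡ a′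
  injective _ _ z z′ with ZUp-shape k<h z | ZUp-shape k<h z′
  ... | zStep pre u′ v post r dpre du′ dv dpost rotation _ _ refl refl
      | zStep pre″ u″ v″ post″ r″ dpre″ du″ dv″ dpost″ rotation″ _ _ refl y≡
    with compose-injective dpre DyckPath-[] (Rot-DyckPath rotation ∷ dv ∷ dpost)
           dpre″ DyckPath-[] (Rot-DyckPath rotation″ ∷ dv″ ∷ dpost″) y≡
  ... | refl , _ , refl with refl ← Rot-injective rotation rotation″ = refl

  forward : ∀ {a} → C⁻ n h (suc k) a → Σ Bits λ b → ZUp n h (suc k) a b × C⁻ n h k b
  forward xa with fromC⁻ xa
  ... | decomposition pre′ .[] post dpre′ _ dpost lp lq refl , refl with initLast pre′ | post
  ... | []         | _ with () ← lp
  ... | pre ∷ʳ′ u′ | [] = ⊥-elim (ℕP.<-irrefl (trans (sym (ℕP.+-identityʳ (suc k))) lq) k<h)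
  ... | pre ∷ʳ′ u′ | v ∷ post′ with refl ← ℕP.suc-injective (trans (sym (length-∷ʳ pre u′)) lp) =
    compose pre [] (r ∷ v ∷ post′) , z ,
    toC⁻ (trans (length-image z) (proj₁ xa))
      (decomposition pre [] (r ∷ v ∷ post′) dpre DyckPath-[] (Rot-DyckPath rotation ∷ All.head dpost ∷ All.tail dpost)
        refl (trans (ℕP.+-suc (length pre) (suc (length post′))) lq) refl) refl
    where
    dpre = AllP.++⁻ˡ pre dpre′
    du′ = All.head (AllP.++⁻ʳ pre dpre′)
    r = proj₁ (rot du′)
    rotation = proj₂ (rot du′)
    z = ZUp-intro dpre du′ (All.head dpost) (All.tail dpost) rotation lq (proj₁ xa)

  backward : ∀ {b} → C⁻ n h k b → Σ Bits λ a → C⁻ n h (suc k) a × ZUp n h (suc k) a b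
  backward yb with fromC⁻ yb
  ... | decomposition pre .[] []            _ _ _ _ lq _ , refl =
    ⊥-elim (ℕP.<-asym k<h (subst (_< suc k) (trans (sym (ℕP.+-identityʳ k)) lq) ℕP.≤-refl))
  ... | decomposition pre .[] (t ∷ [])      _ _ _ _ lq _ , refl =
    ⊥-elim (ℕP.<-irrefl (trans (ℕP.+-comm 1 k) lq) k<h)
  ... | decomposition pre .[] (t ∷ v ∷ post) dpre _ (dt ∷ dv ∷ dpost) refl lq refl , refl with rot⁻¹ dt
  ... | u′ , rotation , du′ =
    compose (pre ++ [ u′ ]) [] (v ∷ post) ,
    toC⁻ len (decomposition (pre ++ [ u′ ]) [] (v ∷ post) (AllP.++⁺ dpre (du′ ∷ [])) DyckPath-[] (dv ∷ dpost)
      (length-∷ʳ pre u′) lengths refl) refl ,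
    z
    where
    lengths : suc (length pre) + suc (length post) ≡ h
    lengths = trans (sym (ℕP.+-suc (length pre) _)) lq
    len′ : length (compose pre [] (t ∷ v ∷ post)) ≡ length (compose (pre ++ [ u′ ]) [] (v ∷ post))
    len′ with Rot-toggle pre (v ∷ post) rotation
    ... | j , _ , eq = trans (cong length eq) (length-toggle (compose (pre ++ [ u′ ]) [] (v ∷ post)) j)
    len : length (compose (pre ++ [ u′ ]) [] (v ∷ post)) ≡ n
    len = trans (sym len′) (proj₁ yb)
    z = ZUp-intro dpre du′ dv dpost rotation lengths len

  perfect :
    PerfectMatching n (Restrict (Z02 n h (suc k)) (C⁻ n h k) (C⁻ n h (suc k))) (C⁻ n h k) (C⁻ n h (suc k))
  perfect = PerfectMatching-swap (perfectMatching record
    { flips      = flips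
    ; length-X   = proj₁
    ; length-Y   = proj₁
    ; disjoint   = disjoint
    ; no-return  = λ { ya xb (len , us , dec , empty , _) → disjoint (len , us , dec , empty) ya }
    ; functional = functional
    ; injective  = injective
    ; forward    = forward
    ; backward   = backward
    })

lemma5 : ∀ n → 3 ≤ n →
    -- (i)
    (∀ h i → i < h → h ≤ n →
      PerfectMatching n (Restrict (Mlex 0) (C n h i) (C n h (1 + i))) (C n h i) (C n h (1 + i)))
    ×
    -- (ii)
    (PerfectMatching n (Restrict (Mlex 1) (C⁻ n 1 0) (C⁻ n 1 1)) (C⁻ n 1 0) (C⁻ n 1 1)
     × (∀ h i → i ≤ h → h + 2 ≤ n →
         PerfectMatching n (Restrict (Mlex 1) (C⁺ n h i) (C⁻ n (h + 2) (i + 2)))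
           (C⁺ n h i) (C⁻ n (h + 2) (i + 2))
         × PerfectMatching n (Restrict (Mlex 1) (C⁺ n h i) (C⁻ n (h + 2) i))
           (C⁺ n h i) (C⁻ n (h + 2) i)))
    ×
    -- (iii)
    (∀ h i → 1 < i → i < h → h ≤ n →
      PerfectMatching n (Restrict (Z02 n h i) (C⁻ n h (i ∸ 1)) (C⁻ n h i))
        (C⁻ n h (i ∸ 1)) (C⁻ n h i))
lemma5 n 3≤n =
  (λ h i i<h _ → Matching-C.perfect n h i i<h) ,
  (Matching-C⁻₁₀.perfect n 3≤n ,
   λ h i i≤h _ → Matching-C⁺-C⁻-up.perfect n h i , Matching-C⁺-C⁻-same.perfect n h i i≤h) ,
  λ { h (suc k) _ i<h _ → Matching-Z.perfect n h k i<h }
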